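{- For any triangular partitions $\tau,\nu$, their join and meet in $\mathbb{Y}_\Delta$ are $$\tau\vee\nu=\mathbb{N}^2\cap\operatorname{Conv}(\tau\cup\nu),\qquad \tau\wedge\nu=\mathbb{N}^2\setminus\Big(\mathbb{N}^2\cap\operatorname{Conv}\big(\mathbb{N}^2\setminus(\tau\cap\nu)\big)\Big).$$
   Context: $\mathbb{N}$ denotes the positive integers. A partition is identified with its Ferrers diagram, a finite subset of $\mathbb{N}^2$. A partition $\tau$ is triangular if there are real $r,s>0$ such that $\tau$ is exactly the set of points of $\mathbb{N}^2$ on or below the line $x/r+y/s=1$. $\mathbb{Y}_\Delta$ is the poset of triangular partitions ordered by inclusion; it is a lattice. $\operatorname{Conv}$ denotes convex hull.
   Formalization: The parameters $r,s>0$ of a triangular partition range over the rationals instead of the reals, and Conv is formed from convex combinations with rational weights. -}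

module Defs where

open import Data.Nat as ℕ using (ℕ)
open import Data.Integer using (+_)
open import Data.Rational using (ℚ; _/_; _+_; _*_; _≤_; _<_; 0ℚ; 1ℚ)
open import Data.Product using (Σ; ∃; ∃-syntax; _×_; _,_)
open import Data.Sum using (_⊎_)
open import Data.List using (List; []; _∷_)
open import Data.List.Relation.Unary.All using (All)
open import Relation.Nullary using (¬_)
open import Function.Bundles using (_⇔_)
open import Relation.Binary.PropositionalEquality using (_≡_)

-- A subset of ℕ × ℕ (ℕ here includes 0; the paper's ℕ = positive integers
-- is carried by the predicate Pos).
Sub : Set₁
Sub = ℕ → ℕ → Set

Pos : ℕ → ℕ → Set
Pos x y = (1 ℕ.≤ x) × (1 ℕ.≤ y)

⟦_⟧ : ℕ → ℚ
⟦ n ⟧ = + n / 1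

_⊆_ : Sub → Sub → Set
S ⊆ T = ∀ x y → S x y → T x y

-- τ is triangular: there are r, s > 0 such that τ is exactly the set of
-- points of ℕ² on or below the line x/r + y/s = 1, i.e. x·s + y·r ≤ r·s.
-- (r, s range over ℚ instead of ℝ.)
Triangular : Sub → Set
Triangular τ =
  Σ ℚ λ r → Σ ℚ λ s → (0ℚ < r) × (0ℚ < s) ×
    (∀ x y → τ x y ⇔ (Pos x y × ((⟦ x ⟧ * s) + (⟦ y ⟧ * r) ≤ r * s)))

wsum : List (ℕ × ℕ × ℚ) → ℚ
wsum [] = 0ℚ
wsum ((a , b , w) ∷ ps) = w + wsum ps

wsumX : List (ℕ × ℕ × ℚ) → ℚ
wsumX [] = 0ℚ
wsumX ((a , b , w) ∷ ps) = (w * ⟦ a ⟧) + wsumX ps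

wsumY : List (ℕ × ℕ × ℚ) → ℚ
wsumY [] = 0ℚ
wsumY ((a , b , w) ∷ ps) = (w * ⟦ b ⟧) + wsumY ps

InConv : Sub → ℕ → ℕ → Set
InConv S x y =
  Σ (List (ℕ × ℕ × ℚ)) λ ps →
    All (λ { (a , b , w) → S a b × (0ℚ ≤ w) }) ps ×
    (wsum ps ≡ 1ℚ) × (wsumX ps ≡ ⟦ x ⟧) × (wsumY ps ≡ ⟦ y ⟧)

_∪_ : Sub → Sub → Sub
(S ∪ T) x y = S x y ⊎ T x y

_∩_ : Sub → Sub → Sub
(S ∩ T) x y = S x y × T x y

Compl : Sub → Sub
Compl S x y = Pos x y × ¬ S x y

HullPts : Sub → Sub
HullPts S x y = Pos x y × InConv S x y

JoinΔ : Sub → Sub → Sub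
JoinΔ τ ν = HullPts (τ ∪ ν)

MeetΔ : Sub → Sub → Sub
MeetΔ τ ν = Compl (HullPts (Compl (τ ∩ ν)))

IsJoinΔ : Sub → Sub → Sub → Set₁
IsJoinΔ τ ν J = Triangular J × τ ⊆ J × ν ⊆ J ×
  (∀ σ → Triangular σ → τ ⊆ σ → ν ⊆ σ → J ⊆ σ)

IsMeetΔ : Sub → Sub → Sub → Set₁
IsMeetΔ τ ν M = Triangular M × M ⊆ τ × M ⊆ ν ×
  (∀ σ → Triangular σ → σ ⊆ τ → σ ⊆ ν → σ ⊆ M)

-- A triangular partition is the set of lattice points (x , y) ≥ (1 , 1) with
-- A x + B y ≤ C for integers A , B ≥ 1, and a lattice point lies in the hull of a set S
-- of lattice points only if it satisfies every such inequality that S satisfies.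
-- If τ ⊆ ν or ν ⊆ τ both formulas are immediate. Otherwise the two lines cross: for
-- some column k, ν ⊆ τ on the columns x ≤ k and τ ⊆ ν on the columns x > k. Among the
-- segments from a point p ∈ τ left of x = k + 1/2 to a point q ∈ ν right of it, take
-- the one meeting that line highest (the upper bridge). All of τ ∪ ν lies below pq, and
-- pq falls, as otherwise a point of τ ∖ ν would lie below q ∈ ν; so pq is the line of a
-- triangular partition containing τ and ν. A lattice point under pq but outside τ ∪ ν
-- lies in a column between p and q: left of p it would lie, together with a point of
-- ν ∖ τ right of p, in the wedge between pq and the line of τ, which never straddles the
-- vertical through p (symmetrically at q). There it is a convex combination of p, q and
-- the point of its column on the bottom row. The meet is dual: the lower bridge of
-- ℕ² ∖ (τ ∩ ν), searched in a box beyond which that set is dominated by the box, with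
-- the top row of the box in place of the bottom row.

module Submission where

open import Defs
open import Data.Nat as ℕ using (ℕ; zero; suc; z≤n; s≤s; _∸_)
import Data.Nat.Properties as ℕₚ
import Data.Nat.Tactic.RingSolver as ℕ-Solver
import Data.Nat.Coprimality as Coprime
open import Data.Integer as ℤ using (ℤ; +_; -[1+_]; 0ℤ; _-_; -_)
  renaming (_+_ to _+ℤ_; _*_ to _*ℤ_; _≤_ to _≤ℤ_; _<_ to _<ℤ_)
import Data.Integer.Properties as ℤₚ
import Data.Integer.Tactic.RingSolver as ℤ-Solver
open import Data.Rational as ℚ using (ℚ; mkℚ; 0ℚ; 1ℚ; toℚᵘ)
import Data.Rational.Properties as ℚₚ
open import Data.Rational.Solver using (module +-*-Solver)
open +-*-Solver using (solve; _:+_; _:*_; _:=_; con)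
import Data.Rational.Unnormalised as ℚᵘ
import Data.Rational.Unnormalised.Properties as ℚᵘₚ
open import Data.Empty using (⊥; ⊥-elim)
open import Data.Product as Product using (∃-syntax; _×_; _,_; proj₁; proj₂)
open import Data.Sum as Sum using (_⊎_; inj₁; inj₂; [_,_]′)
open import Data.List using (List; []; _∷_; map; filter; cartesianProduct; upTo)
open import Data.List.Membership.Propositional using (_∈_; find)
open import Data.List.Membership.Propositional.Properties
  using (∈-filter⁺; ∈-filter⁻; ∈-cartesianProduct⁺; ∈-cartesianProduct⁻; ∈-upTo⁺; ∈-upTo⁻)
open import Data.List.Relation.Unary.All as All using (All; []; _∷_; all?)
open import Data.List.Relation.Unary.All.Properties using (¬All⇒Any¬)
open import Data.List.Extrema ℚᵘₚ.≤-totalOrder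
  using (argmax; argmin; argmax-all; argmin-all; f[xs]≤f[argmax]; f[argmin]≤f[xs])
open import Relation.Nullary using (¬_; Dec; yes; no)
import Relation.Nullary.Decidable as Dec
open import Relation.Nullary.Decidable using (_×-dec_; ¬?; map′)
open import Relation.Unary using (Pred; Decidable)
open import Level using (0ℓ)
open import Function using (id; _∘_)
open import Function.Bundles using (_⇔_; mk⇔; Equivalence)
import Function.Properties.Equivalence as ⇔
open Equivalence using (to; from)
open import Relation.Binary.PropositionalEquality

toℚᵘ-⟦⟧ : ∀ n → toℚᵘ ⟦ n ⟧ ≡ ℚᵘ.mkℚᵘ (+ n) 0
toℚᵘ-⟦⟧ n rewrite ℚₚ.normalize-coprime {n} {0} (Coprime.sym (Coprime.1-coprimeTo n)) = refl

private
  ⟦⟧-homo : (_∙ᴺ_ : ℕ → ℕ → ℕ) (_∙_ : ℚ → ℚ → ℚ) (_∙ᵘ_ : ℚᵘ.ℚᵘ → ℚᵘ.ℚᵘ → ℚᵘ.ℚᵘ) →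
    (∀ p q → toℚᵘ (p ∙ q) ℚᵘ.≃ toℚᵘ p ∙ᵘ toℚᵘ q) →
    (∀ m n → ℚᵘ.mkℚᵘ (+ (m ∙ᴺ n)) 0 ℚᵘ.≃ ℚᵘ.mkℚᵘ (+ m) 0 ∙ᵘ ℚᵘ.mkℚᵘ (+ n) 0) →
    ∀ m n → ⟦ m ∙ᴺ n ⟧ ≡ ⟦ m ⟧ ∙ ⟦ n ⟧
  ⟦⟧-homo _∙ᴺ_ _∙_ _∙ᵘ_ toℚᵘ-homo eq m n = ℚₚ.toℚᵘ-injective (begin
    toℚᵘ ⟦ m ∙ᴺ n ⟧                   ≡⟨ toℚᵘ-⟦⟧ (m ∙ᴺ n) ⟩
    ℚᵘ.mkℚᵘ (+ (m ∙ᴺ n)) 0            ≈⟨ eq m n ⟩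
    ℚᵘ.mkℚᵘ (+ m) 0 ∙ᵘ ℚᵘ.mkℚᵘ (+ n) 0 ≡⟨ sym (cong₂ _∙ᵘ_ (toℚᵘ-⟦⟧ m) (toℚᵘ-⟦⟧ n)) ⟩
    toℚᵘ ⟦ m ⟧ ∙ᵘ toℚᵘ ⟦ n ⟧          ≈⟨ ℚᵘₚ.≃-sym (toℚᵘ-homo ⟦ m ⟧ ⟦ n ⟧) ⟩
    toℚᵘ (⟦ m ⟧ ∙ ⟦ n ⟧)              ∎)
    where open ℚᵘₚ.≃-Reasoning

⟦⟧-homo-+ : ∀ m n → ⟦ m ℕ.+ n ⟧ ≡ ⟦ m ⟧ ℚ.+ ⟦ n ⟧
⟦⟧-homo-+ = ⟦⟧-homo ℕ._+_ ℚ._+_ ℚᵘ._+_ ℚₚ.toℚᵘ-homo-+ λ m n →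
  ℚᵘ.*≡* (trans (cong (_*ℤ + 1) (ℤₚ.pos-+ m n)) (lemma (+ m) (+ n)))
  where
  lemma : ∀ a b → (a +ℤ b) *ℤ + 1 ≡ (a *ℤ + 1 +ℤ b *ℤ + 1) *ℤ + 1
  lemma = ℤ-Solver.solve-∀

⟦⟧-homo-* : ∀ m n → ⟦ m ℕ.* n ⟧ ≡ ⟦ m ⟧ ℚ.* ⟦ n ⟧
⟦⟧-homo-* = ⟦⟧-homo ℕ._*_ ℚ._*_ ℚᵘ._*_ ℚₚ.toℚᵘ-homo-* λ m n →
  ℚᵘ.*≡* (cong (_*ℤ + 1) (ℤₚ.pos-* m n))

⟦⟧-mono-≤ : ∀ {m n} → m ℕ.≤ n → ⟦ m ⟧ ℚ.≤ ⟦ n ⟧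
⟦⟧-mono-≤ {m} {n} m≤n = ℚₚ.toℚᵘ-cancel-≤ (subst₂ ℚᵘ._≤_ (sym (toℚᵘ-⟦⟧ m)) (sym (toℚᵘ-⟦⟧ n))
  (ℚᵘ.*≤* (ℤₚ.*-monoʳ-≤-nonNeg (+ 1) (ℤ.+≤+ m≤n))))

⟦⟧-cancel-≤ : ∀ {m n} → ⟦ m ⟧ ℚ.≤ ⟦ n ⟧ → m ℕ.≤ n
⟦⟧-cancel-≤ {m} {n} ⟦m⟧≤⟦n⟧
  with ℚᵘ.*≤* m≤n ← subst₂ ℚᵘ._≤_ (toℚᵘ-⟦⟧ m) (toℚᵘ-⟦⟧ n) (ℚₚ.toℚᵘ-mono-≤ ⟦m⟧≤⟦n⟧)
  = ℤₚ.drop‿+≤+ (ℤₚ.*-cancelʳ-≤-pos (+ m) (+ n) (+ 1) m≤n)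

⟦⟧-nonNeg : ∀ n → 0ℚ ℚ.≤ ⟦ n ⟧
⟦⟧-nonNeg n = ⟦⟧-mono-≤ {0} {n} z≤n

/suc*⟦suc⟧ : ∀ n d → (+ n ℚ./ suc d) ℚ.* ⟦ suc d ⟧ ≡ ⟦ n ⟧
/suc*⟦suc⟧ n d = ℚₚ.toℚᵘ-injective (begin
  toℚᵘ ((+ n ℚ./ suc d) ℚ.* ⟦ suc d ⟧)             ≈⟨ ℚₚ.toℚᵘ-homo-* (+ n ℚ./ suc d) ⟦ suc d ⟧ ⟩
  toℚᵘ (+ n ℚ./ suc d) ℚᵘ.* toℚᵘ ⟦ suc d ⟧
    ≈⟨ ℚᵘₚ.*-cong (ℚₚ.toℚᵘ-fromℚᵘ (ℚᵘ.mkℚᵘ (+ n) d)) (ℚᵘₚ.≃-reflexive (toℚᵘ-⟦⟧ (suc d))) ⟩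
  ℚᵘ.mkℚᵘ (+ n) d ℚᵘ.* ℚᵘ.mkℚᵘ (+ suc d) 0          ≈⟨ ℚᵘ.*≡* (lemma (+ n) (+ suc d)) ⟩
  ℚᵘ.mkℚᵘ (+ n) 0                                  ≡⟨ sym (toℚᵘ-⟦⟧ n) ⟩
  toℚᵘ ⟦ n ⟧                                        ∎)
  where
  open ℚᵘₚ.≃-Reasoning
  lemma : ∀ a b → (a *ℤ b) *ℤ + 1 ≡ a *ℤ (b *ℤ + 1)
  lemma = ℤ-Solver.solve-∀

-- Convex hulls of lattice points

lin : ℕ → ℕ → ℕ → ℕ → ℕ
lin A B x y = A ℕ.* x ℕ.+ B ℕ.* y

⟦⟧-lin : ∀ A B x y → ⟦ lin A B x y ⟧ ≡ ⟦ A ⟧ ℚ.* ⟦ x ⟧ ℚ.+ ⟦ B ⟧ ℚ.* ⟦ y ⟧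
⟦⟧-lin A B x y = trans (⟦⟧-homo-+ (A ℕ.* x) (B ℕ.* y)) (cong₂ ℚ._+_ (⟦⟧-homo-* A x) (⟦⟧-homo-* B y))

Weighted : Sub → ℕ × ℕ × ℚ → Set
Weighted S (a , b , w) = S a b × 0ℚ ℚ.≤ w

wsumF : (ℕ → ℕ → ℚ) → List (ℕ × ℕ × ℚ) → ℚ
wsumF f [] = 0ℚ
wsumF f ((a , b , w) ∷ ps) = w ℚ.* f a b ℚ.+ wsumF f ps

wsumF-mono : ∀ {S : Sub} {f g} → (∀ a b → S a b → f a b ℚ.≤ g a b) →
  ∀ ps → All (Weighted S) ps → wsumF f ps ℚ.≤ wsumF g ps
wsumF-mono f≤g [] [] = ℚₚ.≤-refl
wsumF-mono f≤g ((a , b , w) ∷ ps) ((s , 0≤w) ∷ ws) =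
  ℚₚ.+-mono-≤ (ℚₚ.*-monoˡ-≤-nonNeg w {{ℚ.nonNegative 0≤w}} (f≤g a b s)) (wsumF-mono f≤g ps ws)

wsumF-lin : ∀ A B ps → wsumF (λ a b → ⟦ lin A B a b ⟧) ps ≡ ⟦ A ⟧ ℚ.* wsumX ps ℚ.+ ⟦ B ⟧ ℚ.* wsumY ps
wsumF-lin A B [] = sym (lemma ⟦ A ⟧ ⟦ B ⟧)
  where
  lemma : ∀ α β → α ℚ.* 0ℚ ℚ.+ β ℚ.* 0ℚ ≡ 0ℚ
  lemma = solve 2 (λ α β → α :* con 0ℚ :+ β :* con 0ℚ := con 0ℚ) refl
wsumF-lin A B ((a , b , w) ∷ ps) = begin
  w ℚ.* ⟦ lin A B a b ⟧ ℚ.+ wsumF (λ a b → ⟦ lin A B a b ⟧) ps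
    ≡⟨ cong₂ (λ u v → w ℚ.* u ℚ.+ v) (⟦⟧-lin A B a b) (wsumF-lin A B ps) ⟩
  w ℚ.* (⟦ A ⟧ ℚ.* ⟦ a ⟧ ℚ.+ ⟦ B ⟧ ℚ.* ⟦ b ⟧) ℚ.+ (⟦ A ⟧ ℚ.* wsumX ps ℚ.+ ⟦ B ⟧ ℚ.* wsumY ps)
    ≡⟨ lemma ⟦ A ⟧ ⟦ B ⟧ w ⟦ a ⟧ ⟦ b ⟧ (wsumX ps) (wsumY ps) ⟩
  ⟦ A ⟧ ℚ.* (w ℚ.* ⟦ a ⟧ ℚ.+ wsumX ps) ℚ.+ ⟦ B ⟧ ℚ.* (w ℚ.* ⟦ b ⟧ ℚ.+ wsumY ps) ∎
  where
  open ≡-Reasoning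
  lemma : ∀ α β w a b X Y → w ℚ.* (α ℚ.* a ℚ.+ β ℚ.* b) ℚ.+ (α ℚ.* X ℚ.+ β ℚ.* Y) ≡
                            α ℚ.* (w ℚ.* a ℚ.+ X) ℚ.+ β ℚ.* (w ℚ.* b ℚ.+ Y)
  lemma = solve 7 (λ α β w a b X Y → w :* (α :* a :+ β :* b) :+ (α :* X :+ β :* Y) :=
                                     α :* (w :* a :+ X) :+ β :* (w :* b :+ Y)) refl

wsumF-const : ∀ c ps → wsumF (λ _ _ → c) ps ≡ c ℚ.* wsum ps
wsumF-const c [] = sym (ℚₚ.*-zeroʳ c)
wsumF-const c ((a , b , w) ∷ ps) =
  trans (cong (w ℚ.* c ℚ.+_) (wsumF-const c ps)) (lemma c w (wsum ps))
  where
  lemma : ∀ c w W → w ℚ.* c ℚ.+ c ℚ.* W ≡ c ℚ.* (w ℚ.+ W)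
  lemma = solve 3 (λ c w W → w :* c :+ c :* W := c :* (w :+ W)) refl

private
  lin≡wsumF : ∀ {x y} ps → wsumX ps ≡ ⟦ x ⟧ → wsumY ps ≡ ⟦ y ⟧ →
    ∀ A B → ⟦ lin A B x y ⟧ ≡ wsumF (λ a b → ⟦ lin A B a b ⟧) ps
  lin≡wsumF {x} {y} ps Σwa≡x Σwb≡y A B = trans (⟦⟧-lin A B x y) (sym (trans (wsumF-lin A B ps)
    (cong₂ (λ u v → ⟦ A ⟧ ℚ.* u ℚ.+ ⟦ B ⟧ ℚ.* v) Σwa≡x Σwb≡y)))

  const≡wsumF : ∀ ps → wsum ps ≡ 1ℚ → ∀ q → q ≡ wsumF (λ _ _ → q) ps
  const≡wsumF ps Σw≡1 q = sym (trans (wsumF-const q ps) (trans (cong (q ℚ.*_) Σw≡1) (ℚₚ.*-identityʳ q)))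

InConv-≤ : ∀ {S : Sub} {x y} → InConv S x y → ∀ {A B C} → (∀ a b → S a b → lin A B a b ℕ.≤ C) → lin A B x y ℕ.≤ C
InConv-≤ (ps , ws , Σw≡1 , Σwa≡x , Σwb≡y) {A} {B} {C} S≤C =
  ⟦⟧-cancel-≤ (subst₂ ℚ._≤_ (sym (lin≡wsumF ps Σwa≡x Σwb≡y A B)) (sym (const≡wsumF ps Σw≡1 ⟦ C ⟧))
    (wsumF-mono (λ a b s → ⟦⟧-mono-≤ (S≤C a b s)) ps ws))

InConv-≥ : ∀ {S : Sub} {x y} → InConv S x y → ∀ {A B C} → (∀ a b → S a b → C ℕ.≤ lin A B a b) → C ℕ.≤ lin A B x y
InConv-≥ (ps , ws , Σw≡1 , Σwa≡x , Σwb≡y) {A} {B} {C} C≤S =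
  ⟦⟧-cancel-≤ (subst₂ ℚ._≤_ (sym (const≡wsumF ps Σw≡1 ⟦ C ⟧)) (sym (lin≡wsumF ps Σwa≡x Σwb≡y A B))
    (wsumF-mono (λ a b s → ⟦⟧-mono-≤ (C≤S a b s)) ps ws))

InConv-mono : ∀ {S T : Sub} → S ⊆ T → ∀ {x y} → InConv S x y → InConv T x y
InConv-mono S⊆T (ps , ws , Σs) = ps , All.map (λ { {a , b , w} (s , 0≤w) → S⊆T a b s , 0≤w }) ws , Σs

InConv-single : ∀ {S : Sub} {x y} → S x y → InConv S x y
InConv-single {x = x} {y} s =
  (x , y , 1ℚ) ∷ [] , (s , ℚₚ.nonNegative⁻¹ 1ℚ) ∷ [] , refl , lemma ⟦ x ⟧ , lemma ⟦ y ⟧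
  where
  lemma : ∀ a → 1ℚ ℚ.* a ℚ.+ 0ℚ ≡ a
  lemma a = trans (ℚₚ.+-identityʳ (1ℚ ℚ.* a)) (ℚₚ.*-identityˡ a)

nsumF : (ℕ → ℕ → ℕ) → List (ℕ × ℕ × ℕ) → ℕ
nsumF f [] = 0
nsumF f ((a , b , n) ∷ ps) = n ℕ.* f a b ℕ.+ nsumF f ps

scale : ℚ → List (ℕ × ℕ × ℕ) → List (ℕ × ℕ × ℚ)
scale c = map λ (a , b , n) → a , b , ⟦ n ⟧ ℚ.* c

wsumF-scale : ∀ c f ps → wsumF (λ a b → ⟦ f a b ⟧) (scale c ps) ≡ ⟦ nsumF f ps ⟧ ℚ.* c
wsumF-scale c f [] = sym (ℚₚ.*-zeroˡ c)
wsumF-scale c f ((a , b , n) ∷ ps) = begin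
  ⟦ n ⟧ ℚ.* c ℚ.* ⟦ f a b ⟧ ℚ.+ wsumF (λ a b → ⟦ f a b ⟧) (scale c ps)
    ≡⟨ cong (⟦ n ⟧ ℚ.* c ℚ.* ⟦ f a b ⟧ ℚ.+_) (wsumF-scale c f ps) ⟩
  ⟦ n ⟧ ℚ.* c ℚ.* ⟦ f a b ⟧ ℚ.+ ⟦ nsumF f ps ⟧ ℚ.* c
    ≡⟨ lemma ⟦ n ⟧ c ⟦ f a b ⟧ ⟦ nsumF f ps ⟧ ⟩
  (⟦ n ⟧ ℚ.* ⟦ f a b ⟧ ℚ.+ ⟦ nsumF f ps ⟧) ℚ.* c
    ≡⟨ cong (ℚ._* c) (sym (trans (⟦⟧-homo-+ (n ℕ.* f a b) _) (cong (ℚ._+ _) (⟦⟧-homo-* n (f a b))))) ⟩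
  ⟦ n ℕ.* f a b ℕ.+ nsumF f ps ⟧ ℚ.* c ∎
  where
  open ≡-Reasoning
  lemma : ∀ n c v N → n ℚ.* c ℚ.* v ℚ.+ N ℚ.* c ≡ (n ℚ.* v ℚ.+ N) ℚ.* c
  lemma = solve 4 (λ n c v N → n :* c :* v :+ N :* c := (n :* v :+ N) :* c) refl

private
  wsum≡wsumF : ∀ ps → wsum ps ≡ wsumF (λ _ _ → ⟦ 1 ⟧) ps
  wsum≡wsumF ps = sym (trans (wsumF-const 1ℚ ps) (ℚₚ.*-identityˡ (wsum ps)))

  wsumX≡wsumF : ∀ ps → wsumX ps ≡ wsumF (λ a _ → ⟦ a ⟧) ps
  wsumX≡wsumF [] = refl
  wsumX≡wsumF ((a , b , w) ∷ ps) = cong (w ℚ.* ⟦ a ⟧ ℚ.+_) (wsumX≡wsumF ps)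

  wsumY≡wsumF : ∀ ps → wsumY ps ≡ wsumF (λ _ b → ⟦ b ⟧) ps
  wsumY≡wsumF [] = refl
  wsumY≡wsumF ((a , b , w) ∷ ps) = cong (w ℚ.* ⟦ b ⟧ ℚ.+_) (wsumY≡wsumF ps)

InConv-ℕ-weights : ∀ {S : Sub} {x y} ps t → All (λ (a , b , _) → S a b) ps →
  nsumF (λ _ _ → 1) ps ≡ suc t → nsumF (λ a _ → a) ps ≡ suc t ℕ.* x → nsumF (λ _ b → b) ps ≡ suc t ℕ.* y →
  InConv S x y
InConv-ℕ-weights {S} {x} {y} ps t inS Σn Σna Σnb =
  scale c ps , weighted ps inS ,
  trans (wsum≡wsumF (scale c ps)) (trans (wsumF-scale c _ ps) (trans (cong (λ m → ⟦ m ⟧ ℚ.* c) Σn) ⟦1+t⟧*c≡1)) ,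
  trans (wsumX≡wsumF (scale c ps)) (trans (wsumF-scale c _ ps) (mean Σna)) ,
  trans (wsumY≡wsumF (scale c ps)) (trans (wsumF-scale c _ ps) (mean Σnb))
  where
  c : ℚ
  c = + 1 ℚ./ suc t
  ⟦1+t⟧*c≡1 : ⟦ suc t ⟧ ℚ.* c ≡ 1ℚ
  ⟦1+t⟧*c≡1 = trans (ℚₚ.*-comm ⟦ suc t ⟧ c) (/suc*⟦suc⟧ 1 t)
  weighted : ∀ ps → All (λ (a , b , _) → S a b) ps → All (Weighted S) (scale c ps)
  weighted [] [] = []
  weighted ((a , b , n) ∷ ps) (s ∷ ss) =
    (s , ℚₚ.nonNegative⁻¹ _ {{ℚₚ.nonNeg*nonNeg⇒nonNeg ⟦ n ⟧ {{ℚ.nonNegative (⟦⟧-nonNeg n)}} c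
                                                     {{ℚₚ.normalize-nonNeg 1 (suc t)}}}})
    ∷ weighted ps ss
  mean : ∀ {m z} → m ≡ suc t ℕ.* z → ⟦ m ⟧ ℚ.* c ≡ ⟦ z ⟧
  mean {m} {z} refl = begin
    ⟦ suc t ℕ.* z ⟧ ℚ.* c       ≡⟨ cong (ℚ._* c) (trans (⟦⟧-homo-* (suc t) z) (ℚₚ.*-comm ⟦ suc t ⟧ ⟦ z ⟧)) ⟩
    ⟦ z ⟧ ℚ.* ⟦ suc t ⟧ ℚ.* c   ≡⟨ ℚₚ.*-assoc ⟦ z ⟧ ⟦ suc t ⟧ c ⟩
    ⟦ z ⟧ ℚ.* (⟦ suc t ⟧ ℚ.* c) ≡⟨ cong (⟦ z ⟧ ℚ.*_) ⟦1+t⟧*c≡1 ⟩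
    ⟦ z ⟧ ℚ.* 1ℚ                ≡⟨ ℚₚ.*-identityʳ ⟦ z ⟧ ⟩
    ⟦ z ⟧                       ∎
    where open ≡-Reasoning

-- Triangular partitions as lattice points under integral lines

record Under (A B C x y : ℕ) : Set where
  constructor under
  field
    pos : Pos x y
    bound : lin A B x y ℕ.≤ C

open Under public

_≐_ : Sub → Sub → Set
S ≐ T = ∀ x y → S x y ⇔ T x y

UnderLine : Sub → Set
UnderLine τ = ∃[ A ] ∃[ B ] ∃[ C ] 1 ℕ.≤ A × 1 ℕ.≤ B × τ ≐ Under A B C

lin-mono : ∀ A B {x y x′ y′} → x ℕ.≤ x′ → y ℕ.≤ y′ → lin A B x y ℕ.≤ lin A B x′ y′
lin-mono A B x≤x′ y≤y′ = ℕₚ.+-mono-≤ (ℕₚ.*-monoʳ-≤ A x≤x′) (ℕₚ.*-monoʳ-≤ B y≤y′)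

Under? : ∀ A B C x y → Dec (Under A B C x y)
Under? A B C x y = map′ (λ (p , le) → under p le) (λ u → pos u , bound u)
  (((1 ℕₚ.≤? x) ×-dec (1 ℕₚ.≤? y)) ×-dec (lin A B x y ℕₚ.≤? C))

Under-downward : ∀ {A B C x y x′ y′} → 1 ℕ.≤ x → 1 ℕ.≤ y → x ℕ.≤ x′ → y ℕ.≤ y′ → Under A B C x′ y′ → Under A B C x y
Under-downward {A} {B} 1≤x 1≤y x≤x′ y≤y′ (under _ le) = under (1≤x , 1≤y) (ℕₚ.≤-trans (lin-mono A B x≤x′ y≤y′) le)

Under-bounded : ∀ {A B C x y} → 1 ℕ.≤ A → 1 ℕ.≤ B → Under A B C x y → x ℕ.≤ C × y ℕ.≤ C
Under-bounded {A} {B} {C} {x} {y} 1≤A 1≤B (under _ le) =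
  ℕₚ.≤-trans (ℕₚ.m≤n*m x A {{ℕ.>-nonZero 1≤A}}) (ℕₚ.≤-trans (ℕₚ.m≤m+n (A ℕ.* x) (B ℕ.* y)) le) ,
  ℕₚ.≤-trans (ℕₚ.m≤n*m y B {{ℕ.>-nonZero 1≤B}}) (ℕₚ.≤-trans (ℕₚ.m≤n+m (B ℕ.* y) (A ℕ.* x)) le)

∉Under⇒< : ∀ {A B C x y} → Pos x y → ¬ Under A B C x y → C ℕ.< lin A B x y
∉Under⇒< z-pos ∉ = ℕₚ.≰⇒> (λ le → ∉ (under z-pos le))

private
  pos⇒/suc : ∀ r → 0ℚ ℚ.< r → ∃[ n ] ∃[ d ] (+ suc n ℚ./ suc d ≡ r)
  pos⇒/suc (mkℚ (+ zero) d c) (ℚ.*<* 0<0) = ⊥-elim (ℤₚ.<-irrefl refl 0<0)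
  pos⇒/suc r@(mkℚ (+ suc n) d c) _ = n , d , ℚₚ.↥p/↧p≡p r
  pos⇒/suc (mkℚ -[1+ n ] d c) (ℚ.*<* 0<r) = ⊥-elim (ℤₚ.<-asym (subst (0ℤ <ℤ_) (ℤₚ.*-identityʳ -[1+ n ]) 0<r) ℤ.-<+)

under-ℚ⇔ℕ : ∀ x y rn rd sn sd → let r = + rn ℚ./ suc rd; s = + sn ℚ./ suc sd in
  (⟦ x ⟧ ℚ.* s ℚ.+ ⟦ y ⟧ ℚ.* r ℚ.≤ r ℚ.* s) ⇔ (lin (sn ℕ.* suc rd) (rn ℕ.* suc sd) x y ℕ.≤ rn ℕ.* sn)
under-ℚ⇔ℕ x y rn rd sn sd = mk⇔
  (λ le → ⟦⟧-cancel-≤ (subst₂ ℚ._≤_ lhs rhs (ℚₚ.*-monoʳ-≤-nonNeg c {{ℚₚ.pos⇒nonNeg c}} le)))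
  (λ le → ℚₚ.*-cancelʳ-≤-pos c (subst₂ ℚ._≤_ (sym lhs) (sym rhs) (⟦⟧-mono-≤ le)))
  where
  r = + rn ℚ./ suc rd
  s = + sn ℚ./ suc sd
  c = ⟦ suc rd ⟧ ℚ.* ⟦ suc sd ⟧
  instance
    c-pos : ℚ.Positive c
    c-pos = ℚₚ.pos*pos⇒pos ⟦ suc rd ⟧ {{ℚₚ.normalize-pos (suc rd) 1}} ⟦ suc sd ⟧ {{ℚₚ.normalize-pos (suc sd) 1}}
  lhs : (⟦ x ⟧ ℚ.* s ℚ.+ ⟦ y ⟧ ℚ.* r) ℚ.* c ≡ ⟦ lin (sn ℕ.* suc rd) (rn ℕ.* suc sd) x y ⟧
  lhs = begin
    (⟦ x ⟧ ℚ.* s ℚ.+ ⟦ y ⟧ ℚ.* r) ℚ.* c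
      ≡⟨ lemma ⟦ x ⟧ ⟦ y ⟧ r s ⟦ suc rd ⟧ ⟦ suc sd ⟧ ⟩
    (s ℚ.* ⟦ suc sd ⟧) ℚ.* ⟦ suc rd ⟧ ℚ.* ⟦ x ⟧ ℚ.+ (r ℚ.* ⟦ suc rd ⟧) ℚ.* ⟦ suc sd ⟧ ℚ.* ⟦ y ⟧
      ≡⟨ cong₂ (λ u v → u ℚ.* ⟦ suc rd ⟧ ℚ.* ⟦ x ⟧ ℚ.+ v ℚ.* ⟦ suc sd ⟧ ℚ.* ⟦ y ⟧) (/suc*⟦suc⟧ sn sd) (/suc*⟦suc⟧ rn rd) ⟩
    ⟦ sn ⟧ ℚ.* ⟦ suc rd ⟧ ℚ.* ⟦ x ⟧ ℚ.+ ⟦ rn ⟧ ℚ.* ⟦ suc sd ⟧ ℚ.* ⟦ y ⟧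
      ≡⟨ sym (cong₂ (λ u v → u ℚ.* ⟦ x ⟧ ℚ.+ v ℚ.* ⟦ y ⟧) (⟦⟧-homo-* sn (suc rd)) (⟦⟧-homo-* rn (suc sd))) ⟩
    ⟦ sn ℕ.* suc rd ⟧ ℚ.* ⟦ x ⟧ ℚ.+ ⟦ rn ℕ.* suc sd ⟧ ℚ.* ⟦ y ⟧
      ≡⟨ sym (⟦⟧-lin (sn ℕ.* suc rd) (rn ℕ.* suc sd) x y) ⟩
    ⟦ lin (sn ℕ.* suc rd) (rn ℕ.* suc sd) x y ⟧ ∎
    where
    open ≡-Reasoning
    lemma : ∀ x y r s R S → (x ℚ.* s ℚ.+ y ℚ.* r) ℚ.* (R ℚ.* S) ≡ (s ℚ.* S) ℚ.* R ℚ.* x ℚ.+ (r ℚ.* R) ℚ.* S ℚ.* y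
    lemma = solve 6 (λ x y r s R S → (x :* s :+ y :* r) :* (R :* S) := (s :* S) :* R :* x :+ (r :* R) :* S :* y) refl
  rhs : r ℚ.* s ℚ.* c ≡ ⟦ rn ℕ.* sn ⟧
  rhs = begin
    r ℚ.* s ℚ.* c                                ≡⟨ lemma r s ⟦ suc rd ⟧ ⟦ suc sd ⟧ ⟩
    (r ℚ.* ⟦ suc rd ⟧) ℚ.* (s ℚ.* ⟦ suc sd ⟧)    ≡⟨ cong₂ ℚ._*_ (/suc*⟦suc⟧ rn rd) (/suc*⟦suc⟧ sn sd) ⟩
    ⟦ rn ⟧ ℚ.* ⟦ sn ⟧                            ≡⟨ sym (⟦⟧-homo-* rn sn) ⟩
    ⟦ rn ℕ.* sn ⟧                                ∎
    where
    open ≡-Reasoning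
    lemma : ∀ r s R S → r ℚ.* s ℚ.* (R ℚ.* S) ≡ (r ℚ.* R) ℚ.* (s ℚ.* S)
    lemma = solve 4 (λ r s R S → r :* s :* (R :* S) := (r :* R) :* (s :* S)) refl

triangular⇒underLine : ∀ {τ} → Triangular τ → UnderLine τ
triangular⇒underLine {τ} (r , s , 0<r , 0<s , τ≐)
  with rn , rd , refl ← pos⇒/suc r 0<r | sn , sd , refl ← pos⇒/suc s 0<s =
  suc sn ℕ.* suc rd , suc rn ℕ.* suc sd , suc rn ℕ.* suc sn , s≤s z≤n , s≤s z≤n ,
  λ x y → mk⇔ (λ t → let (p , le) = to (τ≐ x y) t in under p (to (under-ℚ⇔ℕ x y (suc rn) rd (suc sn) sd) le))
              (λ (under p le) → from (τ≐ x y) (p , from (under-ℚ⇔ℕ x y (suc rn) rd (suc sn) sd) le))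

-- r = (2C+1)/2A and s = (2C+1)/2B: the extra half keeps the empty partition C = 0 uniform.
underLine⇒triangular : ∀ {τ} → UnderLine τ → Triangular τ
underLine⇒triangular {τ} (suc a , suc b , C , _ , _ , τ≐) =
  + N ℚ./ 2A , + N ℚ./ 2B , ℚₚ.positive⁻¹ _ {{ℚₚ.normalize-pos N 2A}} , ℚₚ.positive⁻¹ _ {{ℚₚ.normalize-pos N 2B}} ,
  λ x y → mk⇔ (λ t → let (under p le) = to (τ≐ x y) t in p , from (cleared x y) (scale-up x y le))
              (λ (p , le) → from (τ≐ x y) (under p (scale-down x y (to (cleared x y) le))))
  where
  N 2A 2B : ℕ
  N = suc (2 ℕ.* C)
  2A = suc (suc (2 ℕ.* a))
  2B = suc (suc (2 ℕ.* b))
  cleared : ∀ x y → (⟦ x ⟧ ℚ.* (+ N ℚ./ 2B) ℚ.+ ⟦ y ⟧ ℚ.* (+ N ℚ./ 2A) ℚ.≤ (+ N ℚ./ 2A) ℚ.* (+ N ℚ./ 2B)) ⇔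
                    (lin (N ℕ.* 2A) (N ℕ.* 2B) x y ℕ.≤ N ℕ.* N)
  cleared x y = under-ℚ⇔ℕ x y N (suc (2 ℕ.* a)) N (suc (2 ℕ.* b))
  eq : ∀ x y → lin (N ℕ.* 2A) (N ℕ.* 2B) x y ≡ N ℕ.* (2 ℕ.* lin (suc a) (suc b) x y)
  eq x y = lemma N a b x y
    where
    lemma : ∀ N a b x y → N ℕ.* suc (suc (2 ℕ.* a)) ℕ.* x ℕ.+ N ℕ.* suc (suc (2 ℕ.* b)) ℕ.* y ≡
                          N ℕ.* (2 ℕ.* (suc a ℕ.* x ℕ.+ suc b ℕ.* y))
    lemma = ℕ-Solver.solve-∀
  scale-up : ∀ x y → lin (suc a) (suc b) x y ℕ.≤ C → lin (N ℕ.* 2A) (N ℕ.* 2B) x y ℕ.≤ N ℕ.* N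
  scale-up x y le = subst (ℕ._≤ N ℕ.* N) (sym (eq x y)) (ℕₚ.*-monoʳ-≤ N (ℕₚ.m≤n⇒m≤1+n (ℕₚ.*-monoʳ-≤ 2 le)))
  scale-down : ∀ x y → lin (N ℕ.* 2A) (N ℕ.* 2B) x y ℕ.≤ N ℕ.* N → lin (suc a) (suc b) x y ℕ.≤ C
  scale-down x y le = ℕₚ.≤-pred (ℕₚ.*-cancelˡ-< 2 _ (suc C) (begin-strict
    2 ℕ.* lin (suc a) (suc b) x y  ≤⟨ ℕₚ.*-cancelˡ-≤ N (subst (ℕ._≤ N ℕ.* N) (eq x y) le) ⟩
    N                              <⟨ ℕₚ.n<1+n N ⟩
    2 ℕ.+ 2 ℕ.* C                  ≡⟨ ℕₚ.*-suc 2 C ⟨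
    2 ℕ.* suc C                    ∎))
    where open ℕₚ.≤-Reasoning

-- Lines and wedges in ℤ²

private
  variable
    i j : ℤ

  >0*>0 : 0ℤ <ℤ i → 0ℤ <ℤ j → 0ℤ <ℤ i *ℤ j
  >0*>0 {i} 0<i 0<j = subst (_<ℤ i *ℤ _) (ℤₚ.*-zeroʳ i) (ℤₚ.*-monoˡ-<-pos i {{ℤ.positive 0<i}} 0<j)

  >0*≤0 : 0ℤ <ℤ i → j ≤ℤ 0ℤ → i *ℤ j ≤ℤ 0ℤ
  >0*≤0 {i} 0<i j≤0 = subst (i *ℤ _ ≤ℤ_) (ℤₚ.*-zeroʳ i) (ℤₚ.*-monoˡ-≤-nonNeg i {{ℤ.nonNegative (ℤₚ.<⇒≤ 0<i)}} j≤0)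

  >0*-cancel->0 : 0ℤ <ℤ i → 0ℤ <ℤ i *ℤ j → 0ℤ <ℤ j
  >0*-cancel->0 {i} 0<i 0<ij =
    ℤₚ.*-cancelˡ-<-nonNeg i {{ℤ.nonNegative (ℤₚ.<⇒≤ 0<i)}} (subst (_<ℤ i *ℤ _) (sym (ℤₚ.*-zeroʳ i)) 0<ij)

  >0*-cancel-≤0 : 0ℤ <ℤ i → i *ℤ j ≤ℤ 0ℤ → j ≤ℤ 0ℤ
  >0*-cancel-≤0 {i} {j} 0<i ij≤0 =
    ℤₚ.*-cancelˡ-≤-pos j 0ℤ i {{ℤ.positive 0<i}} (subst (i *ℤ j ≤ℤ_) (sym (ℤₚ.*-zeroʳ i)) ij≤0)

  >0*-cancel-≥0 : 0ℤ <ℤ i → 0ℤ ≤ℤ i *ℤ j → 0ℤ ≤ℤ j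
  >0*-cancel-≥0 {i} {j} 0<i 0≤ij =
    ℤₚ.*-cancelˡ-≤-pos 0ℤ j i {{ℤ.positive 0<i}} (subst (_≤ℤ i *ℤ j) (sym (ℤₚ.*-zeroʳ i)) 0≤ij)

  i<j⇒0<j-i : i <ℤ j → 0ℤ <ℤ j - i
  i<j⇒0<j-i {i} {j} i<j = subst (_<ℤ j - i) (ℤₚ.+-inverseʳ i) (ℤₚ.+-monoˡ-< (- i) i<j)

  i<j⇒i-j<0 : i <ℤ j → i - j <ℤ 0ℤ
  i<j⇒i-j<0 {i} {j} i<j = subst (i - j <ℤ_) (ℤₚ.+-inverseʳ j) (ℤₚ.+-monoˡ-< (- j) i<j)

  ≥0*≥0 : 0ℤ ≤ℤ i → 0ℤ ≤ℤ j → 0ℤ ≤ℤ i *ℤ j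
  ≥0*≥0 {i} 0≤i 0≤j = subst (_≤ℤ i *ℤ _) (ℤₚ.*-zeroʳ i) (ℤₚ.*-monoˡ-≤-nonNeg i {{ℤ.nonNegative 0≤i}} 0≤j)

  ∸≡- : ∀ {m n} → n ℕ.≤ m → + (m ℕ.∸ n) ≡ + m - + n
  ∸≡- {m} {n} n≤m = trans (sym (ℤₚ.⊖-≥ n≤m)) (sym (ℤₚ.m-n≡m⊖n m n))

Point : Set
Point = ℕ × ℕ

Vec : Set
Vec = ℤ × ℤ

_-ᵥ_ : Point → Point → Vec
(ux , uy) -ᵥ (ox , oy) = + ux - + ox , + uy - + oy

dot : ℤ → ℤ → Vec → ℤ
dot a b (vx , vy) = a *ℤ vx +ℤ b *ℤ vy

lin-diff : ∀ A B ((ux , uy) (ox , oy) : Point) → + lin A B ux uy - + lin A B ox oy ≡ dot (+ A) (+ B) ((ux , uy) -ᵥ (ox , oy))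
lin-diff A B (ux , uy) (ox , oy) = begin
  + lin A B ux uy - + lin A B ox oy
    ≡⟨ cong₂ _-_ (cast ux uy) (cast ox oy) ⟩
  (+ A *ℤ + ux +ℤ + B *ℤ + uy) - (+ A *ℤ + ox +ℤ + B *ℤ + oy)
    ≡⟨ lemma (+ A) (+ B) (+ ux) (+ uy) (+ ox) (+ oy) ⟩
  dot (+ A) (+ B) ((ux , uy) -ᵥ (ox , oy)) ∎
  where
  open ≡-Reasoning
  cast : ∀ x y → + lin A B x y ≡ + A *ℤ + x +ℤ + B *ℤ + y
  cast x y = trans (ℤₚ.pos-+ (A ℕ.* x) (B ℕ.* y)) (cong₂ _+ℤ_ (ℤₚ.pos-* A x) (ℤₚ.pos-* B y))
  lemma : ∀ a b ux uy ox oy → (a *ℤ ux +ℤ b *ℤ uy) - (a *ℤ ox +ℤ b *ℤ oy) ≡ a *ℤ (ux - ox) +ℤ b *ℤ (uy - oy)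
  lemma = ℤ-Solver.solve-∀

lin<⇒0<dot : ∀ {A B} u o → lin A B (proj₁ o) (proj₂ o) ℕ.< lin A B (proj₁ u) (proj₂ u) → 0ℤ <ℤ dot (+ A) (+ B) (u -ᵥ o)
lin<⇒0<dot {A} {B} u o o<u = subst (0ℤ <ℤ_) (lin-diff A B u o) (i<j⇒0<j-i (ℤ.+<+ o<u))

lin≤⇒dot≤0 : ∀ {A B} u o → lin A B (proj₁ u) (proj₂ u) ℕ.≤ lin A B (proj₁ o) (proj₂ o) → dot (+ A) (+ B) (u -ᵥ o) ≤ℤ 0ℤ
lin≤⇒dot≤0 {A} {B} u o u≤o = subst (_≤ℤ 0ℤ) (lin-diff A B u o) (ℤₚ.i≤j⇒i-j≤0 (ℤ.+≤+ u≤o))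

-- Two vectors strictly above one non-vertical line through 0 and weakly below another
-- cannot point to opposite sides: otherwise a positive combination of them is vertical,
-- (-w₁) v + v₁ w = (0 , c), and c would be both positive and non-positive.
wedge-one-sided : ∀ {a b e d : ℤ} {v w : Vec} → 0ℤ <ℤ b → 0ℤ <ℤ d → 0ℤ <ℤ proj₁ v → proj₁ w <ℤ 0ℤ →
  0ℤ <ℤ dot a b v → 0ℤ <ℤ dot a b w → dot e d v ≤ℤ 0ℤ → dot e d w ≤ℤ 0ℤ → ⊥
wedge-one-sided {a} {b} {e} {d} {vx , vy} {wx , wy} 0<b 0<d 0<vx wx<0 0<av 0<aw ev≤0 ew≤0 =
  ℤₚ.<-irrefl refl (ℤₚ.<-≤-trans 0<c c≤0)
  where
  c = (- wx) *ℤ vy +ℤ vx *ℤ wy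
  combine : ∀ a b → (- wx) *ℤ dot a b (vx , vy) +ℤ vx *ℤ dot a b (wx , wy) ≡ b *ℤ c
  combine a b = lemma a b vx vy wx wy
    where
    lemma : ∀ a b vx vy wx wy → (- wx) *ℤ (a *ℤ vx +ℤ b *ℤ vy) +ℤ vx *ℤ (a *ℤ wx +ℤ b *ℤ wy) ≡
                                b *ℤ ((- wx) *ℤ vy +ℤ vx *ℤ wy)
    lemma = ℤ-Solver.solve-∀
  0<-wx : 0ℤ <ℤ - wx
  0<-wx = ℤₚ.neg-mono-< wx<0
  0<c : 0ℤ <ℤ c
  0<c = >0*-cancel->0 0<b (subst (0ℤ <ℤ_) (combine a b) (ℤₚ.+-mono-< (>0*>0 0<-wx 0<av) (>0*>0 0<vx 0<aw)))
  c≤0 : c ≤ℤ 0ℤ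
  c≤0 = >0*-cancel-≤0 0<d (subst (_≤ℤ 0ℤ) (combine e d) (ℤₚ.+-mono-≤ (>0*≤0 0<-wx ev≤0) (>0*≤0 0<vx ew≤0)))

-- side p q u ≤ 0 iff u lies on or below the line pq (for p₁ < q₁).
side : Point → Point → Point → ℤ
side p@(px , py) (qx , qy) u = dot (+ py - + qy) (+ qx - + px) (u -ᵥ p)

private
  side-from-q : ∀ px py qx qy ux uy → side (px , py) (qx , qy) (ux , uy) ≡
    (+ qx - + px) *ℤ (+ uy - + qy) +ℤ (+ qy - + py) *ℤ (+ qx - + ux)
  side-from-q px py qx qy ux uy = lemma (+ px) (+ py) (+ qx) (+ qy) (+ ux) (+ uy)
    where
    lemma : ∀ px py qx qy ux uy → (py - qy) *ℤ (ux - px) +ℤ (qx - px) *ℤ (uy - py) ≡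
                                 (qx - px) *ℤ (uy - qy) +ℤ (qy - py) *ℤ (qx - ux)
    lemma = ℤ-Solver.solve-∀

below-rising-line : ∀ {px py qx qy ux uy} → py ℕ.≤ qy → ux ℕ.≤ qx → px ℕ.< qx →
  side (px , py) (qx , qy) (ux , uy) ≤ℤ 0ℤ → uy ℕ.≤ qy
below-rising-line {px} {py} {qx} {qy} {ux} {uy} py≤qy ux≤qx px<qx below =
  ℤₚ.drop‿+≤+ (ℤₚ.i-j≤0⇒i≤j (>0*-cancel-≤0 (i<j⇒0<j-i (ℤ.+<+ px<qx)) (begin
    (+ qx - + px) *ℤ (+ uy - + qy)
      ≤⟨ ℤₚ.i≤i+j _ ((+ qy - + py) *ℤ (+ qx - + ux)) {{ℤ.nonNegative rise}} ⟩
    (+ qx - + px) *ℤ (+ uy - + qy) +ℤ (+ qy - + py) *ℤ (+ qx - + ux)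
      ≡⟨ side-from-q px py qx qy ux uy ⟨
    side (px , py) (qx , qy) (ux , uy)
      ≤⟨ below ⟩
    0ℤ ∎)))
  where
  open ℤₚ.≤-Reasoning
  rise : 0ℤ ≤ℤ (+ qy - + py) *ℤ (+ qx - + ux)
  rise = ≥0*≥0 (ℤₚ.i≤j⇒0≤j-i (ℤ.+≤+ py≤qy)) (ℤₚ.i≤j⇒0≤j-i (ℤ.+≤+ ux≤qx))

above-rising-line : ∀ {px py qx qy ux uy} → py ℕ.≤ qy → px ℕ.≤ ux → px ℕ.< qx →
  0ℤ ≤ℤ side (px , py) (qx , qy) (ux , uy) → py ℕ.≤ uy
above-rising-line {px} {py} {qx} {qy} {ux} {uy} py≤qy px≤ux px<qx above =
  ℤₚ.drop‿+≤+ (ℤₚ.0≤i-j⇒j≤i (>0*-cancel-≥0 (i<j⇒0<j-i (ℤ.+<+ px<qx)) (begin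
    0ℤ
      ≤⟨ above ⟩
    side (px , py) (qx , qy) (ux , uy)
      ≤⟨ ℤₚ.i≤i+j _ ((+ qy - + py) *ℤ (+ ux - + px)) {{ℤ.nonNegative rise}} ⟩
    side (px , py) (qx , qy) (ux , uy) +ℤ (+ qy - + py) *ℤ (+ ux - + px)
      ≡⟨ lemma (+ px) (+ py) (+ qx) (+ qy) (+ ux) (+ uy) ⟩
    (+ qx - + px) *ℤ (+ uy - + py) ∎)))
  where
  open ℤₚ.≤-Reasoning
  rise : 0ℤ ≤ℤ (+ qy - + py) *ℤ (+ ux - + px)
  rise = ≥0*≥0 (ℤₚ.i≤j⇒0≤j-i (ℤ.+≤+ py≤qy)) (ℤₚ.i≤j⇒0≤j-i (ℤ.+≤+ px≤ux))
  lemma : ∀ px py qx qy ux uy → (py - qy) *ℤ (ux - px) +ℤ (qx - px) *ℤ (uy - py) +ℤ (qy - py) *ℤ (ux - px) ≡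
                               (qx - px) *ℤ (uy - py)
  lemma = ℤ-Solver.solve-∀

below-wedge-one-sided : ∀ {A B E D} → 1 ℕ.≤ B → 1 ℕ.≤ D → ∀ {(ox , oy) (ux , uy) (vx , vy) : Point} →
  ux ℕ.< ox → ox ℕ.< vx → lin A B ox oy ℕ.< lin A B ux uy → lin A B ox oy ℕ.< lin A B vx vy →
  lin E D ux uy ℕ.≤ lin E D ox oy → lin E D vx vy ℕ.≤ lin E D ox oy → ⊥
below-wedge-one-sided {A} {B} {E} {D} 1≤B 1≤D {o} {u} {v} ux<ox ox<vx ou ov uo vo =
  wedge-one-sided {+ A} {+ B} {+ E} {+ D} {v -ᵥ o} {u -ᵥ o} (ℤ.+<+ 1≤B) (ℤ.+<+ 1≤D)
    (i<j⇒0<j-i (ℤ.+<+ ox<vx)) (i<j⇒i-j<0 (ℤ.+<+ ux<ox))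
    (lin<⇒0<dot {A} {B} v o ov) (lin<⇒0<dot {A} {B} u o ou) (lin≤⇒dot≤0 {E} {D} v o vo) (lin≤⇒dot≤0 {E} {D} u o uo)

above-wedge-one-sided : ∀ {A B E D} → 1 ℕ.≤ B → 1 ℕ.≤ D → ∀ {(ox , oy) (ux , uy) (vx , vy) : Point} →
  ux ℕ.< ox → ox ℕ.< vx → lin A B ux uy ℕ.< lin A B ox oy → lin A B vx vy ℕ.< lin A B ox oy →
  lin E D ox oy ℕ.≤ lin E D ux uy → lin E D ox oy ℕ.≤ lin E D vx vy → ⊥
above-wedge-one-sided {A} {B} {E} {D} 1≤B 1≤D {o} {u} {v} ux<ox ox<vx uo vo ou ov =
  wedge-one-sided {+ A} {+ B} {+ E} {+ D} {o -ᵥ u} {o -ᵥ v} (ℤ.+<+ 1≤B) (ℤ.+<+ 1≤D)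
    (i<j⇒0<j-i (ℤ.+<+ ux<ox)) (i<j⇒i-j<0 (ℤ.+<+ ox<vx))
    (lin<⇒0<dot {A} {B} o u uo) (lin<⇒0<dot {A} {B} o v vo) (lin≤⇒dot≤0 {E} {D} o u ou) (lin≤⇒dot≤0 {E} {D} o v ov)

column-triple : ∀ {S : Sub} {x₀ i j ya yb yr yz h g t} → S x₀ ya → S (x₀ ℕ.+ i ℕ.+ j) yb → S (x₀ ℕ.+ i) yr →
  lin i j h h ℕ.+ g ≡ suc t → j ℕ.* h ℕ.* ya ℕ.+ i ℕ.* h ℕ.* yb ℕ.+ g ℕ.* yr ≡ suc t ℕ.* yz →
  InConv S (x₀ ℕ.+ i) yz
column-triple {x₀ = x₀} {i} {j} {ya} {yb} {yr} {yz} {h} {g} {t} sa sb sr Σw Σwy =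
  InConv-ℕ-weights ((x₀ , ya , j ℕ.* h) ∷ (x₀ ℕ.+ i ℕ.+ j , yb , i ℕ.* h) ∷ (x₀ ℕ.+ i , yr , g) ∷ []) t
    (sa ∷ sb ∷ sr ∷ [])
    (trans (weights i j h g) Σw)
    (trans (weighted-x x₀ i j h g) (cong (ℕ._* (x₀ ℕ.+ i)) Σw))
    (trans (weighted-y i j h g ya yb yr) Σwy)
  where
  weights : ∀ i j h g → j ℕ.* h ℕ.* 1 ℕ.+ (i ℕ.* h ℕ.* 1 ℕ.+ (g ℕ.* 1 ℕ.+ 0)) ≡ i ℕ.* h ℕ.+ j ℕ.* h ℕ.+ g
  weights = ℕ-Solver.solve-∀
  weighted-x : ∀ x₀ i j h g → j ℕ.* h ℕ.* x₀ ℕ.+ (i ℕ.* h ℕ.* (x₀ ℕ.+ i ℕ.+ j) ℕ.+ (g ℕ.* (x₀ ℕ.+ i) ℕ.+ 0)) ≡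
                              (i ℕ.* h ℕ.+ j ℕ.* h ℕ.+ g) ℕ.* (x₀ ℕ.+ i)
  weighted-x = ℕ-Solver.solve-∀
  weighted-y : ∀ i j h g ya yb yr → j ℕ.* h ℕ.* ya ℕ.+ (i ℕ.* h ℕ.* yb ℕ.+ (g ℕ.* yr ℕ.+ 0)) ≡
                                    j ℕ.* h ℕ.* ya ℕ.+ i ℕ.* h ℕ.* yb ℕ.+ g ℕ.* yr
  weighted-y = ℕ-Solver.solve-∀

private
  +-cast : ∀ {a b c} → a ℕ.+ b ≡ c → + a ≡ + c - + b
  +-cast {a} {b} refl = trans (sym (lemma (+ a) (+ b))) (cong (_- + b) (sym (ℤₚ.pos-+ a b)))
    where
    lemma : ∀ a b → (a +ℤ b) - b ≡ a
    lemma = ℤ-Solver.solve-∀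

  side-column : ∀ px i j py qy y →
    side (px , py) (px ℕ.+ i ℕ.+ j , qy) (px ℕ.+ i , y) ≡ + i *ℤ (+ py - + qy) +ℤ (+ i +ℤ + j) *ℤ (+ y - + py)
  side-column px i j py qy y = begin
    (+ py - + qy) *ℤ (+ (px ℕ.+ i) - + px) +ℤ (+ (px ℕ.+ i ℕ.+ j) - + px) *ℤ (+ y - + py)
      ≡⟨ cong₂ (λ a b → (+ py - + qy) *ℤ (a - + px) +ℤ (b - + px) *ℤ (+ y - + py))
               (ℤₚ.pos-+ px i) (trans (ℤₚ.pos-+ (px ℕ.+ i) j) (cong (_+ℤ + j) (ℤₚ.pos-+ px i))) ⟩
    (+ py - + qy) *ℤ ((+ px +ℤ + i) - + px) +ℤ ((+ px +ℤ + i +ℤ + j) - + px) *ℤ (+ y - + py)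
      ≡⟨ lemma (+ px) (+ i) (+ j) (+ py) (+ qy) (+ y) ⟩
    + i *ℤ (+ py - + qy) +ℤ (+ i +ℤ + j) *ℤ (+ y - + py) ∎
    where
    open ≡-Reasoning
    lemma : ∀ px i j py qy y → (py - qy) *ℤ ((px +ℤ i) - px) +ℤ ((px +ℤ i +ℤ j) - px) *ℤ (y - py) ≡
                              i *ℤ (py - qy) +ℤ (i +ℤ j) *ℤ (y - py)
    lemma = ℤ-Solver.solve-∀

  -- h, P and Q are the distances of z, p and q from r; p, q and r get weights j h, i h and g.
  column-combination : ∀ {S : Sub} {x₀ i j ya yb yr yz h P Q} → S x₀ ya → S (x₀ ℕ.+ i ℕ.+ j) yb → S (x₀ ℕ.+ i) yr →
    1 ℕ.≤ i ℕ.+ j → lin i j h h ℕ.≤ lin i j Q P → (h ≡ 0 → yz ≡ yr) →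
    (∀ {g} → lin i j h h ℕ.+ g ≡ lin i j Q P → j ℕ.* h ℕ.* ya ℕ.+ i ℕ.* h ℕ.* yb ℕ.+ g ℕ.* yr ≡ lin i j Q P ℕ.* yz) →
    InConv S (x₀ ℕ.+ i) yz
  column-combination {S} {x₀} {i} {j} {yr = yr} {yz} {h} {P} {Q} sa sb sr 1≤i+j h≤ h≡0⇒z≡r Σwy with lin i j Q P
  ... | suc t = column-triple sa sb sr (ℕₚ.m+[n∸m]≡n h≤) (Σwy (ℕₚ.m+[n∸m]≡n h≤))
  ... | zero = subst (InConv S (x₀ ℕ.+ i)) (sym (h≡0⇒z≡r h≡0)) (InConv-single sr)
    where
    h≡0 : h ≡ 0
    h≡0 = ℕₚ.n≤0⇒n≡0 (begin
      h                     ≤⟨ ℕₚ.m≤n*m h (i ℕ.+ j) {{ℕ.>-nonZero 1≤i+j}} ⟩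
      (i ℕ.+ j) ℕ.* h       ≡⟨ ℕₚ.*-distribʳ-+ h i j ⟩
      lin i j h h           ≤⟨ h≤ ⟩
      0                     ∎)
      where open ℕₚ.≤-Reasoning

  1≤i+j : ∀ {px i j} → px ℕ.< px ℕ.+ i ℕ.+ j → 1 ℕ.≤ i ℕ.+ j
  1≤i+j {px} {i} {j} px<qx = ℕₚ.+-cancelˡ-< px 0 (i ℕ.+ j) (subst₂ ℕ._<_ (sym (ℕₚ.+-identityʳ px)) (ℕₚ.+-assoc px i j) px<qx)

column-below : ∀ {S : Sub} {px py qx qy x y} → S px py → S qx qy → S x 1 →
  px ℕ.≤ x → x ℕ.≤ qx → px ℕ.< qx → 1 ℕ.≤ py → 1 ℕ.≤ qy → 1 ℕ.≤ y →
  side (px , py) (qx , qy) (x , y) ≤ℤ 0ℤ → InConv S x y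
column-below {S} {px} {suc P} {qx} {suc Q} {x} {suc h} sp sq sr px≤x x≤qx px<qx (s≤s _) (s≤s _) (s≤s _) below
  with i , refl ← ℕₚ.m≤n⇒∃[o]m+o≡n px≤x
  with j , refl ← ℕₚ.m≤n⇒∃[o]m+o≡n x≤qx
  = column-combination sp sq sr (1≤i+j px<qx) h≤T (cong suc) Σwy
  where
  side≡ : side (px , suc P) (px ℕ.+ i ℕ.+ j , suc Q) (px ℕ.+ i , suc h) ≡ + lin i j h h - + lin i j Q P
  side≡ = trans (side-column px i j (suc P) (suc Q) (suc h))
                (trans (lemma (+ i) (+ j) (+ P) (+ Q) (+ h)) (sym (lin-diff i j (h , h) (Q , P))))
    where
    lemma : ∀ i j P Q h → i *ℤ ((+ 1 +ℤ P) - (+ 1 +ℤ Q)) +ℤ (i +ℤ j) *ℤ ((+ 1 +ℤ h) - (+ 1 +ℤ P)) ≡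
                          i *ℤ (h - Q) +ℤ j *ℤ (h - P)
    lemma = ℤ-Solver.solve-∀
  h≤T : lin i j h h ℕ.≤ lin i j Q P
  h≤T = ℤₚ.drop‿+≤+ (ℤₚ.i-j≤0⇒i≤j (subst (_≤ℤ 0ℤ) side≡ below))
  Σwy : ∀ {g} → lin i j h h ℕ.+ g ≡ lin i j Q P →
        j ℕ.* h ℕ.* suc P ℕ.+ i ℕ.* h ℕ.* suc Q ℕ.+ g ℕ.* 1 ≡ lin i j Q P ℕ.* suc h
  Σwy {g} total = begin
    j ℕ.* h ℕ.* suc P ℕ.+ i ℕ.* h ℕ.* suc Q ℕ.+ g ℕ.* 1  ≡⟨ lemma i j h g P Q ⟩
    (lin i j h h ℕ.+ g) ℕ.+ h ℕ.* lin i j Q P            ≡⟨ cong (ℕ._+ h ℕ.* lin i j Q P) total ⟩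
    lin i j Q P ℕ.+ h ℕ.* lin i j Q P                    ≡⟨ ℕₚ.*-comm (suc h) (lin i j Q P) ⟩
    lin i j Q P ℕ.* suc h                                ∎
    where
    open ≡-Reasoning
    lemma : ∀ i j h g P Q → j ℕ.* h ℕ.* suc P ℕ.+ i ℕ.* h ℕ.* suc Q ℕ.+ g ℕ.* 1 ≡
                            (i ℕ.* h ℕ.+ j ℕ.* h ℕ.+ g) ℕ.+ h ℕ.* (i ℕ.* Q ℕ.+ j ℕ.* P)
    lemma = ℕ-Solver.solve-∀

column-above : ∀ {S : Sub} {px py qx qy x y H} → S px py → S qx qy → S x H →
  px ℕ.≤ x → x ℕ.≤ qx → px ℕ.< qx → py ℕ.≤ H → qy ℕ.≤ H → y ℕ.≤ H →
  0ℤ ≤ℤ side (px , py) (qx , qy) (x , y) → InConv S x y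
column-above {S} {px} {py} {qx} {qy} {x} {y} {H} sp sq sr px≤x x≤qx px<qx py≤H qy≤H y≤H above
  with i , refl ← ℕₚ.m≤n⇒∃[o]m+o≡n px≤x
  with j , refl ← ℕₚ.m≤n⇒∃[o]m+o≡n x≤qx
  with P , py+P≡H ← ℕₚ.m≤n⇒∃[o]m+o≡n py≤H
  with Q , qy+Q≡H ← ℕₚ.m≤n⇒∃[o]m+o≡n qy≤H
  with h , y+h≡H ← ℕₚ.m≤n⇒∃[o]m+o≡n y≤H
  = column-combination sp sq sr (1≤i+j px<qx) h≤T (λ { refl → trans (sym (ℕₚ.+-identityʳ y)) y+h≡H }) Σwy
  where
  side≡ : side (px , py) (px ℕ.+ i ℕ.+ j , qy) (px ℕ.+ i , y) ≡ + lin i j Q P - + lin i j h h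
  side≡ = trans (side-column px i j py qy y)
                (trans (lemma {+ i} {+ j} {+ H} {+ P} {+ Q} {+ h} (+-cast {py} py+P≡H) (+-cast {qy} qy+Q≡H) (+-cast {y} y+h≡H))
                       (sym (lin-diff i j (Q , P) (h , h))))
    where
    lemma : ∀ {i j H P Q h py qy y} → py ≡ H - P → qy ≡ H - Q → y ≡ H - h →
            i *ℤ (py - qy) +ℤ (i +ℤ j) *ℤ (y - py) ≡ i *ℤ (Q - h) +ℤ j *ℤ (P - h)
    lemma {i} {j} {H} {P} {Q} {h} refl refl refl = ring i j H P Q h
      where
      ring : ∀ i j H P Q h → i *ℤ ((H - P) - (H - Q)) +ℤ (i +ℤ j) *ℤ ((H - h) - (H - P)) ≡ i *ℤ (Q - h) +ℤ j *ℤ (P - h)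
      ring = ℤ-Solver.solve-∀
  h≤T : lin i j h h ℕ.≤ lin i j Q P
  h≤T = ℤₚ.drop‿+≤+ (ℤₚ.0≤i-j⇒j≤i (subst (0ℤ ≤ℤ_) side≡ above))
  Σwy : ∀ {g} → lin i j h h ℕ.+ g ≡ lin i j Q P →
        j ℕ.* h ℕ.* py ℕ.+ i ℕ.* h ℕ.* qy ℕ.+ g ℕ.* H ≡ lin i j Q P ℕ.* y
  Σwy {g} total = ℕₚ.+-cancelʳ-≡ (lin i j Q P ℕ.* h) _ _ (begin
    j ℕ.* h ℕ.* py ℕ.+ i ℕ.* h ℕ.* qy ℕ.+ g ℕ.* H ℕ.+ lin i j Q P ℕ.* h
      ≡⟨ lemma₁ i j h g P Q py qy H ⟩
    j ℕ.* h ℕ.* (py ℕ.+ P) ℕ.+ i ℕ.* h ℕ.* (qy ℕ.+ Q) ℕ.+ g ℕ.* H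
      ≡⟨ cong₂ (λ a b → j ℕ.* h ℕ.* a ℕ.+ i ℕ.* h ℕ.* b ℕ.+ g ℕ.* H) py+P≡H qy+Q≡H ⟩
    j ℕ.* h ℕ.* H ℕ.+ i ℕ.* h ℕ.* H ℕ.+ g ℕ.* H
      ≡⟨ lemma₂ i j h g H ⟩
    (lin i j h h ℕ.+ g) ℕ.* H
      ≡⟨ cong₂ ℕ._*_ total (sym y+h≡H) ⟩
    lin i j Q P ℕ.* (y ℕ.+ h)
      ≡⟨ ℕₚ.*-distribˡ-+ (lin i j Q P) y h ⟩
    lin i j Q P ℕ.* y ℕ.+ lin i j Q P ℕ.* h ∎)
    where
    open ≡-Reasoning
    lemma₁ : ∀ i j h g P Q py qy H → j ℕ.* h ℕ.* py ℕ.+ i ℕ.* h ℕ.* qy ℕ.+ g ℕ.* H ℕ.+ (i ℕ.* Q ℕ.+ j ℕ.* P) ℕ.* h ≡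
                                     j ℕ.* h ℕ.* (py ℕ.+ P) ℕ.+ i ℕ.* h ℕ.* (qy ℕ.+ Q) ℕ.+ g ℕ.* H
    lemma₁ = ℕ-Solver.solve-∀
    lemma₂ : ∀ i j h g H → j ℕ.* h ℕ.* H ℕ.+ i ℕ.* h ℕ.* H ℕ.+ g ℕ.* H ≡ (i ℕ.* h ℕ.+ j ℕ.* h ℕ.+ g) ℕ.* H
    lemma₂ = ℕ-Solver.solve-∀

-- Bridges

≤ᵘ-by-sign : ∀ {x y : ℚᵘ.ℚᵘ} {c s : ℤ} → 0ℤ <ℤ c → ℚᵘ.↥ x *ℤ ℚᵘ.↧ y - ℚᵘ.↥ y *ℤ ℚᵘ.↧ x ≡ c *ℤ s →
  (x ℚᵘ.≤ y → s ≤ℤ 0ℤ) × (y ℚᵘ.≤ x → 0ℤ ≤ℤ s)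
≤ᵘ-by-sign 0<c eq =
  (λ { (ℚᵘ.*≤* le) → >0*-cancel-≤0 0<c (subst (_≤ℤ 0ℤ) eq (ℤₚ.i≤j⇒i-j≤0 le)) }) ,
  (λ { (ℚᵘ.*≤* le) → >0*-cancel-≥0 0<c (subst (0ℤ ≤ℤ_) eq (ℤₚ.i≤j⇒0≤j-i le)) })

-- height k (a , b) is the height of the segment ab on the vertical line x = k + 1/2;
-- dₗ and dᵣ are twice the horizontal distances of a₁ ≤ k and b₁ > k to that line.
module Height (k : ℕ) where

  dₗ dᵣ : ℕ → ℕ
  dₗ ax = suc ((k ∸ ax) ℕ.+ (k ∸ ax))
  dᵣ bx = suc ((bx ∸ suc k) ℕ.+ (bx ∸ suc k))

  height : Point × Point → ℚᵘ.ℚᵘ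
  height ((ax , ay) , (bx , by)) = + (ay ℕ.* dᵣ bx ℕ.+ by ℕ.* dₗ ax) ℚᵘ./ (dₗ ax ℕ.+ dᵣ bx)

  0<dₗ+dₗ : ∀ ax → 0ℤ <ℤ + dₗ ax +ℤ + dₗ ax
  0<dₗ+dₗ _ = ℤ.+<+ (s≤s z≤n)

  0<dᵣ+dᵣ : ∀ bx → 0ℤ <ℤ + dᵣ bx +ℤ + dᵣ bx
  0<dᵣ+dᵣ _ = ℤ.+<+ (s≤s z≤n)

  private
    K : ℤ
    K = + k

    Dₗ Dᵣ : ℤ → ℤ
    Dₗ ax = (K - ax) +ℤ (K - ax) +ℤ + 1
    Dᵣ bx = (bx - K) +ℤ (bx - K) - + 1

    dₗ-cast : ∀ {ax} → ax ℕ.≤ k → + dₗ ax ≡ Dₗ (+ ax)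
    dₗ-cast {ax} ax≤k = begin
      + dₗ ax                                    ≡⟨ ℤₚ.pos-+ (suc zero) _ ⟩
      + 1 +ℤ + ((k ∸ ax) ℕ.+ (k ∸ ax))           ≡⟨ cong (+ 1 +ℤ_) (ℤₚ.pos-+ (k ∸ ax) (k ∸ ax)) ⟩
      + 1 +ℤ (+ (k ∸ ax) +ℤ + (k ∸ ax))          ≡⟨ cong (λ d → + 1 +ℤ (d +ℤ d)) (∸≡- ax≤k) ⟩
      + 1 +ℤ ((K - + ax) +ℤ (K - + ax))          ≡⟨ ℤₚ.+-comm (+ 1) ((K - + ax) +ℤ (K - + ax)) ⟩
      Dₗ (+ ax)                                  ∎
      where open ≡-Reasoning

    dᵣ-cast : ∀ {bx} → k ℕ.< bx → + dᵣ bx ≡ Dᵣ (+ bx)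
    dᵣ-cast {bx} k<bx = begin
      + dᵣ bx                                          ≡⟨ ℤₚ.pos-+ (suc zero) _ ⟩
      + 1 +ℤ + ((bx ∸ suc k) ℕ.+ (bx ∸ suc k))         ≡⟨ cong (+ 1 +ℤ_) (ℤₚ.pos-+ (bx ∸ suc k) (bx ∸ suc k)) ⟩
      + 1 +ℤ (+ (bx ∸ suc k) +ℤ + (bx ∸ suc k))        ≡⟨ cong (λ d → + 1 +ℤ (d +ℤ d)) (∸≡- k<bx) ⟩
      + 1 +ℤ ((+ bx - (+ 1 +ℤ K)) +ℤ (+ bx - (+ 1 +ℤ K))) ≡⟨ lemma (+ bx) K ⟩
      Dᵣ (+ bx)                                        ∎
      where
      open ≡-Reasoning
      lemma : ∀ b K → + 1 +ℤ ((b - (+ 1 +ℤ K)) +ℤ (b - (+ 1 +ℤ K))) ≡ (b - K) +ℤ (b - K) - + 1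
      lemma = ℤ-Solver.solve-∀

    ↥-cast : ∀ {ax ay bx by} → ax ℕ.≤ k → k ℕ.< bx →
      ℚᵘ.↥ height ((ax , ay) , (bx , by)) ≡ + ay *ℤ Dᵣ (+ bx) +ℤ + by *ℤ Dₗ (+ ax)
    ↥-cast {ax} {ay} {bx} {by} ax≤k k<bx = trans (ℤₚ.pos-+ (ay ℕ.* dᵣ bx) (by ℕ.* dₗ ax))
      (cong₂ _+ℤ_ (trans (ℤₚ.pos-* ay (dᵣ bx)) (cong (+ ay *ℤ_) (dᵣ-cast k<bx)))
                  (trans (ℤₚ.pos-* by (dₗ ax)) (cong (+ by *ℤ_) (dₗ-cast ax≤k))))

    ↧-cast : ∀ {ax ay bx by} → ax ℕ.≤ k → k ℕ.< bx →
      ℚᵘ.↧ height ((ax , ay) , (bx , by)) ≡ Dₗ (+ ax) +ℤ Dᵣ (+ bx)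
    ↧-cast {ax} {bx = bx} ax≤k k<bx = trans (ℤₚ.pos-+ (dₗ ax) (dᵣ bx)) (cong₂ _+ℤ_ (dₗ-cast ax≤k) (dᵣ-cast k<bx))

  height-cmpₗ : ∀ {p q u : Point} → proj₁ p ℕ.≤ k → proj₁ u ℕ.≤ k → k ℕ.< proj₁ q →
    ℚᵘ.↥ height (u , q) *ℤ ℚᵘ.↧ height (p , q) - ℚᵘ.↥ height (p , q) *ℤ ℚᵘ.↧ height (u , q) ≡
    (+ dᵣ (proj₁ q) +ℤ + dᵣ (proj₁ q)) *ℤ side p q u
  height-cmpₗ {px , py} {qx , qy} {ux , uy} px≤k ux≤k k<qx
    = trans (cong₂ _-_ (cong₂ _*ℤ_ (↥-cast {ux} {uy} {qx} {qy} ux≤k k<qx) (↧-cast {px} {py} {qx} {qy} px≤k k<qx))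
                       (cong₂ _*ℤ_ (↥-cast {px} {py} {qx} {qy} px≤k k<qx) (↧-cast {ux} {uy} {qx} {qy} ux≤k k<qx)))
     (trans (lemma K (+ px) (+ py) (+ qx) (+ qy) (+ ux) (+ uy))
            (cong (λ d → (d +ℤ d) *ℤ side (px , py) (qx , qy) (ux , uy)) (sym (dᵣ-cast k<qx))))
    where
    lemma : ∀ K px py qx qy ux uy → let Dₗ x = (K - x) +ℤ (K - x) +ℤ + 1; Dᵣ x = (x - K) +ℤ (x - K) - + 1 in
      (uy *ℤ Dᵣ qx +ℤ qy *ℤ Dₗ ux) *ℤ (Dₗ px +ℤ Dᵣ qx) - (py *ℤ Dᵣ qx +ℤ qy *ℤ Dₗ px) *ℤ (Dₗ ux +ℤ Dᵣ qx) ≡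
      (Dᵣ qx +ℤ Dᵣ qx) *ℤ ((py - qy) *ℤ (ux - px) +ℤ (qx - px) *ℤ (uy - py))
    lemma = ℤ-Solver.solve-∀

  height-cmpᵣ : ∀ {p q u : Point} → proj₁ p ℕ.≤ k → k ℕ.< proj₁ u → k ℕ.< proj₁ q →
    ℚᵘ.↥ height (p , u) *ℤ ℚᵘ.↧ height (p , q) - ℚᵘ.↥ height (p , q) *ℤ ℚᵘ.↧ height (p , u) ≡
    (+ dₗ (proj₁ p) +ℤ + dₗ (proj₁ p)) *ℤ side p q u
  height-cmpᵣ {px , py} {qx , qy} {ux , uy} px≤k k<ux k<qx
    = trans (cong₂ _-_ (cong₂ _*ℤ_ (↥-cast {px} {py} {ux} {uy} px≤k k<ux) (↧-cast {px} {py} {qx} {qy} px≤k k<qx))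
                       (cong₂ _*ℤ_ (↥-cast {px} {py} {qx} {qy} px≤k k<qx) (↧-cast {px} {py} {ux} {uy} px≤k k<ux)))
     (trans (lemma K (+ px) (+ py) (+ qx) (+ qy) (+ ux) (+ uy))
            (cong (λ d → (d +ℤ d) *ℤ side (px , py) (qx , qy) (ux , uy)) (sym (dₗ-cast px≤k))))
    where
    lemma : ∀ K px py qx qy ux uy → let Dₗ x = (K - x) +ℤ (K - x) +ℤ + 1; Dᵣ x = (x - K) +ℤ (x - K) - + 1 in
      (py *ℤ Dᵣ ux +ℤ uy *ℤ Dₗ px) *ℤ (Dₗ px +ℤ Dᵣ qx) - (py *ℤ Dᵣ qx +ℤ qy *ℤ Dₗ px) *ℤ (Dₗ px +ℤ Dᵣ ux) ≡
      (Dₗ px +ℤ Dₗ px) *ℤ ((py - qy) *ℤ (ux - px) +ℤ (qx - px) *ℤ (uy - py))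
    lemma = ℤ-Solver.solve-∀

-- The upper (lower) bridge between point sets L and R separated by x = k + 1/2 is the
-- segment pq, p ∈ L and q ∈ R, meeting that line highest (lowest); all of L and R lie
-- below (above) its line.
module Bridge (k : ℕ) {L R : List Point}
  (L-left : ∀ {u} → u ∈ L → proj₁ u ℕ.≤ k) (R-right : ∀ {u} → u ∈ R → k ℕ.< proj₁ u)
  {p₀ q₀ : Point} (p₀∈L : p₀ ∈ L) (q₀∈R : q₀ ∈ R) where

  open Height k

  private
    pairs : List (Point × Point)
    pairs = cartesianProduct L R

    choose : (f : (Point × Point → ℚᵘ.ℚᵘ) → Point × Point → List (Point × Point) → Point × Point) →
             (∀ {P : Point × Point → Set} → P (p₀ , q₀) → All.All P pairs → P (f height (p₀ , q₀) pairs)) →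
             ∃[ p ] ∃[ q ] p ∈ L × q ∈ R × (p , q) ≡ f height (p₀ , q₀) pairs
    choose f f-all
      with f height (p₀ , q₀) pairs
         | f-all {λ pq → proj₁ pq ∈ L × proj₂ pq ∈ R} (p₀∈L , q₀∈R) (All.tabulate (∈-cartesianProduct⁻ L R))
    ... | p , q | p∈L , q∈R = p , q , p∈L , q∈R , refl

  upper-bridge : ∃[ p ] ∃[ q ] p ∈ L × q ∈ R × (∀ {u} → u ∈ L ⊎ u ∈ R → side p q u ≤ℤ 0ℤ)
  upper-bridge with p , q , p∈L , q∈R , pq≡ ← choose argmax (λ {P} → argmax-all height {P})
    = p , q , p∈L , q∈R , below
    where
    highest : ∀ {a b} → a ∈ L → b ∈ R → height (a , b) ℚᵘ.≤ height (p , q)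
    highest {a} {b} a∈L b∈R = subst (λ m → height (a , b) ℚᵘ.≤ height m) (sym pq≡)
      (All.lookup (f[xs]≤f[argmax] (p₀ , q₀) pairs) (∈-cartesianProduct⁺ a∈L b∈R))
    below : ∀ {u} → u ∈ L ⊎ u ∈ R → side p q u ≤ℤ 0ℤ
    below {u} (inj₁ u∈L) = proj₁ (≤ᵘ-by-sign (0<dᵣ+dᵣ (proj₁ q))
      (height-cmpₗ {p} {q} {u} (L-left p∈L) (L-left u∈L) (R-right q∈R))) (highest u∈L q∈R)
    below {u} (inj₂ u∈R) = proj₁ (≤ᵘ-by-sign (0<dₗ+dₗ (proj₁ p))
      (height-cmpᵣ {p} {q} {u} (L-left p∈L) (R-right u∈R) (R-right q∈R))) (highest p∈L u∈R)

  lower-bridge : ∃[ p ] ∃[ q ] p ∈ L × q ∈ R × (∀ {u} → u ∈ L ⊎ u ∈ R → 0ℤ ≤ℤ side p q u)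
  lower-bridge with p , q , p∈L , q∈R , pq≡ ← choose argmin (λ {P} p₀ ps → argmin-all height {P = P} p₀ ps)
    = p , q , p∈L , q∈R , above
    where
    lowest : ∀ {a b} → a ∈ L → b ∈ R → height (p , q) ℚᵘ.≤ height (a , b)
    lowest {a} {b} a∈L b∈R = subst (λ m → height m ℚᵘ.≤ height (a , b)) (sym pq≡)
      (All.lookup (f[argmin]≤f[xs] (p₀ , q₀) pairs) (∈-cartesianProduct⁺ a∈L b∈R))
    above : ∀ {u} → u ∈ L ⊎ u ∈ R → 0ℤ ≤ℤ side p q u
    above {u} (inj₁ u∈L) = proj₂ (≤ᵘ-by-sign (0<dᵣ+dᵣ (proj₁ q))
      (height-cmpₗ {p} {q} {u} (L-left p∈L) (L-left u∈L) (R-right q∈R))) (lowest u∈L q∈R)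
    above {u} (inj₂ u∈R) = proj₂ (≤ᵘ-by-sign (0<dₗ+dₗ (proj₁ p))
      (height-cmpᵣ {p} {q} {u} (L-left p∈L) (R-right u∈R) (R-right q∈R))) (lowest p∈L u∈R)

-- Two crossing triangular partitions

opaque
  cells : {P : Pred Point 0ℓ} → Decidable P → ℕ → List Point
  cells P? M = filter P? (cartesianProduct (upTo (suc M)) (upTo (suc M)))

  ∈-cells⁺ : ∀ {P : Pred Point 0ℓ} (P? : Decidable P) {M x y} → x ℕ.≤ M → y ℕ.≤ M → P (x , y) → (x , y) ∈ cells P? M
  ∈-cells⁺ P? x≤M y≤M p = ∈-filter⁺ P? (∈-cartesianProduct⁺ (∈-upTo⁺ (s≤s x≤M)) (∈-upTo⁺ (s≤s y≤M))) p

  ∈-cells⁻ : ∀ {P : Pred Point 0ℓ} (P? : Decidable P) {M x y} → (x , y) ∈ cells P? M → (x ℕ.≤ M × y ℕ.≤ M) × P (x , y)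
  ∈-cells⁻ P? {M} u∈ with u∈box , p ← ∈-filter⁻ P? u∈
    with x∈ , y∈ ← ∈-cartesianProduct⁻ (upTo (suc M)) (upTo (suc M)) u∈box
    = (ℕₚ.≤-pred (∈-upTo⁻ x∈) , ℕₚ.≤-pred (∈-upTo⁻ y∈)) , p

module Line {px py qx qy : ℕ} (px<qx : px ℕ.< qx) (qy<py : qy ℕ.< py) where

  E D : ℕ
  E = py ∸ qy
  D = qx ∸ px

  1≤E : 1 ℕ.≤ E
  1≤E = ℕₚ.m<n⇒0<n∸m qy<py

  1≤D : 1 ℕ.≤ D
  1≤D = ℕₚ.m<n⇒0<n∸m px<qx

  side≡lin : ∀ ux uy → side (px , py) (qx , qy) (ux , uy) ≡ + lin E D ux uy - + lin E D px py
  side≡lin ux uy = begin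
    side (px , py) (qx , qy) (ux , uy)
      ≡⟨ cong₂ (λ e d → dot e d ((ux , uy) -ᵥ (px , py))) (∸≡- (ℕₚ.<⇒≤ qy<py)) (∸≡- (ℕₚ.<⇒≤ px<qx)) ⟨
    dot (+ E) (+ D) ((ux , uy) -ᵥ (px , py))
      ≡⟨ lin-diff E D (ux , uy) (px , py) ⟨
    + lin E D ux uy - + lin E D px py ∎
    where open ≡-Reasoning

  below⇒≤ : ∀ {ux uy} → side (px , py) (qx , qy) (ux , uy) ≤ℤ 0ℤ → lin E D ux uy ℕ.≤ lin E D px py
  below⇒≤ {ux} {uy} below = ℤₚ.drop‿+≤+ (ℤₚ.i-j≤0⇒i≤j (subst (_≤ℤ 0ℤ) (side≡lin ux uy) below))

  ≤⇒below : ∀ {ux uy} → lin E D ux uy ℕ.≤ lin E D px py → side (px , py) (qx , qy) (ux , uy) ≤ℤ 0ℤ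
  ≤⇒below {ux} {uy} le = subst (_≤ℤ 0ℤ) (sym (side≡lin ux uy)) (ℤₚ.i≤j⇒i-j≤0 (ℤ.+≤+ le))

  above⇒≥ : ∀ {ux uy} → 0ℤ ≤ℤ side (px , py) (qx , qy) (ux , uy) → lin E D px py ℕ.≤ lin E D ux uy
  above⇒≥ {ux} {uy} above = ℤₚ.drop‿+≤+ (ℤₚ.0≤i-j⇒j≤i (subst (0ℤ ≤ℤ_) (side≡lin ux uy) above))

  ≥⇒above : ∀ {ux uy} → lin E D px py ℕ.≤ lin E D ux uy → 0ℤ ≤ℤ side (px , py) (qx , qy) (ux , uy)
  ≥⇒above {ux} {uy} ge = subst (0ℤ ≤ℤ_) (sym (side≡lin ux uy)) (ℤₚ.i≤j⇒0≤j-i (ℤ.+≤+ ge))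

  q-on-line : lin E D qx qy ≡ lin E D px py
  q-on-line = ℤₚ.+-injective (ℤₚ.i-j≡0⇒i≡j _ _ (trans (sym (side≡lin qx qy)) (lemma (+ px) (+ py) (+ qx) (+ qy))))
    where
    lemma : ∀ px py qx qy → (py - qy) *ℤ (qx - px) +ℤ (qx - px) *ℤ (qy - py) ≡ 0ℤ
    lemma = ℤ-Solver.solve-∀

-- ℕ² ∩ Conv S is Under A B C.
record HullLine (S : Sub) (A B C : ℕ) : Set where
  constructor mkHullLine
  field
    below  : ∀ a b → S a b → lin A B a b ℕ.≤ C
    covers : ∀ x y → Under A B C x y → InConv S x y

-- ℕ² ∩ Conv S is the complement of Under A B C.
record CoHullLine (S : Sub) (A B C : ℕ) : Set where
  constructor mkCoHullLine
  field
    above  : ∀ a b → S a b → C ℕ.< lin A B a b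
    covers : ∀ x y → Pos x y → C ℕ.< lin A B x y → InConv S x y

module Crossing {A₁ B₁ C₁ A₂ B₂ C₂ : ℕ} (1≤A₁ : 1 ℕ.≤ A₁) (1≤B₁ : 1 ℕ.≤ B₁) (1≤A₂ : 1 ℕ.≤ A₂) (1≤B₂ : 1 ℕ.≤ B₂)
  (k : ℕ)
  (ν⊆τ-left : ∀ {x y} → x ℕ.≤ k → Under A₂ B₂ C₂ x y → Under A₁ B₁ C₁ x y)
  (τ⊆ν-right : ∀ {x y} → k ℕ.< x → Under A₁ B₁ C₁ x y → Under A₂ B₂ C₂ x y)
  {tx ty} (t∈τ : Under A₁ B₁ C₁ tx ty) (t∉ν : ¬ Under A₂ B₂ C₂ tx ty)
  {nx ny} (n∈ν : Under A₂ B₂ C₂ nx ny) (n∉τ : ¬ Under A₁ B₁ C₁ nx ny) where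

  τ ν : Sub
  τ = Under A₁ B₁ C₁
  ν = Under A₂ B₂ C₂

  tx≤k : tx ℕ.≤ k
  tx≤k = ℕₚ.≮⇒≥ (λ k<tx → t∉ν (τ⊆ν-right k<tx t∈τ))

  k<nx : k ℕ.< nx
  k<nx = ℕₚ.≰⇒> (λ nx≤k → n∉τ (ν⊆τ-left nx≤k n∈ν))

  -- τ and ν lie in [0, M − 1]², so row and column M lie outside both.
  M : ℕ
  M = suc (C₁ ℕ.+ C₂)

  C₁<M : C₁ ℕ.< M
  C₁<M = s≤s (ℕₚ.m≤m+n C₁ C₂)

  C₂<M : C₂ ℕ.< M
  C₂<M = s≤s (ℕₚ.m≤n+m C₂ C₁)

  τ-in-box : ∀ {x y} → τ x y → x ℕ.≤ M × y ℕ.≤ M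
  τ-in-box u with x≤C , y≤C ← Under-bounded 1≤A₁ 1≤B₁ u = ℕₚ.≤-trans x≤C (ℕₚ.<⇒≤ C₁<M) , ℕₚ.≤-trans y≤C (ℕₚ.<⇒≤ C₁<M)

  ν-in-box : ∀ {x y} → ν x y → x ℕ.≤ M × y ℕ.≤ M
  ν-in-box u with x≤C , y≤C ← Under-bounded 1≤A₂ 1≤B₂ u = ℕₚ.≤-trans x≤C (ℕₚ.<⇒≤ C₂<M) , ℕₚ.≤-trans y≤C (ℕₚ.<⇒≤ C₂<M)

  module Join where

    Left Right : Pred Point 0ℓ
    Left (a , b) = a ℕ.≤ k × τ a b
    Right (a , b) = k ℕ.< a × ν a b

    Left? : Decidable Left
    Left? (a , b) = (a ℕₚ.≤? k) ×-dec Under? A₁ B₁ C₁ a b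

    Right? : Decidable Right
    Right? (a , b) = (suc k ℕₚ.≤? a) ×-dec Under? A₂ B₂ C₂ a b

    L R : List Point
    L = cells Left? M
    R = cells Right? M

    ∈L⁻ : ∀ {a b} → (a , b) ∈ L → a ℕ.≤ k × τ a b
    ∈L⁻ = proj₂ ∘ ∈-cells⁻ Left?

    ∈R⁻ : ∀ {a b} → (a , b) ∈ R → k ℕ.< a × ν a b
    ∈R⁻ = proj₂ ∘ ∈-cells⁻ Right?

    L-left : ∀ {u} → u ∈ L → proj₁ u ℕ.≤ k
    L-left = proj₁ ∘ ∈L⁻

    R-right : ∀ {u} → u ∈ R → k ℕ.< proj₁ u
    R-right = proj₁ ∘ ∈R⁻

    t∈L : (tx , ty) ∈ L
    t∈L = ∈-cells⁺ Left? (proj₁ (τ-in-box t∈τ)) (proj₂ (τ-in-box t∈τ)) (tx≤k , t∈τ)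

    n∈R : (nx , ny) ∈ R
    n∈R = ∈-cells⁺ Right? (proj₁ (ν-in-box n∈ν)) (proj₂ (ν-in-box n∈ν)) (k<nx , n∈ν)

    ∪⇒∈ : ∀ {a b} → (τ ∪ ν) a b → (a , b) ∈ L ⊎ (a , b) ∈ R
    ∪⇒∈ {a} {b} u with a ℕₚ.≤? k
    ... | yes a≤k = inj₁ (let u∈τ = [ id , ν⊆τ-left a≤k ]′ u in
                          ∈-cells⁺ Left? (proj₁ (τ-in-box u∈τ)) (proj₂ (τ-in-box u∈τ)) (a≤k , u∈τ))
    ... | no a≰k = inj₂ (let k<a = ℕₚ.≰⇒> a≰k; u∈ν = [ τ⊆ν-right k<a , id ]′ u in
                         ∈-cells⁺ Right? (proj₁ (ν-in-box u∈ν)) (proj₂ (ν-in-box u∈ν)) (k<a , u∈ν))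

    module FromBridge {px py qx qy : ℕ} (p∈L : (px , py) ∈ L) (q∈R : (qx , qy) ∈ R)
      (below-bridge : ∀ {u} → u ∈ L ⊎ u ∈ R → side (px , py) (qx , qy) u ≤ℤ 0ℤ) where

      px≤k : px ℕ.≤ k
      px≤k = proj₁ (∈L⁻ p∈L)

      p∈τ : τ px py
      p∈τ = proj₂ (∈L⁻ p∈L)

      k<qx : k ℕ.< qx
      k<qx = proj₁ (∈R⁻ q∈R)

      q∈ν : ν qx qy
      q∈ν = proj₂ (∈R⁻ q∈R)

      px<qx : px ℕ.< qx
      px<qx = ℕₚ.≤-<-trans px≤k k<qx

      tx<qx : tx ℕ.< qx
      tx<qx = ℕₚ.≤-<-trans tx≤k k<qx

      below-line : ∀ {a b} → (τ ∪ ν) a b → side (px , py) (qx , qy) (a , b) ≤ℤ 0ℤ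
      below-line u = below-bridge (∪⇒∈ u)

      -- otherwise t ∈ τ ∖ ν would lie below q ∈ ν
      qy<py : qy ℕ.< py
      qy<py = ℕₚ.≰⇒> λ py≤qy → t∉ν (Under-downward (proj₁ (pos t∈τ)) (proj₂ (pos t∈τ)) (ℕₚ.<⇒≤ tx<qx)
        (below-rising-line py≤qy (ℕₚ.<⇒≤ tx<qx) px<qx (below-line (inj₁ t∈τ))) q∈ν)

      open Line px<qx qy<py

      C : ℕ
      C = lin E D px py

      below-C : ∀ {a b} → (τ ∪ ν) a b → lin E D a b ℕ.≤ C
      below-C u = below⇒≤ (below-line u)

      ∉τ⇒px≤x : ∀ {x y} → Pos x y → ¬ τ x y → lin E D x y ℕ.≤ C → px ℕ.≤ x
      ∉τ⇒px≤x {x} {y} z-pos z∉τ z≤C = ℕₚ.≮⇒≥ λ x<px →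
        below-wedge-one-sided {A₁} {B₁} {E} {D} 1≤B₁ 1≤D {px , py} {x , y} {nx , ny}
          x<px (ℕₚ.≤-<-trans px≤k k<nx)
          (ℕₚ.≤-<-trans (bound p∈τ) (∉Under⇒< z-pos z∉τ)) (ℕₚ.≤-<-trans (bound p∈τ) (∉Under⇒< (pos n∈ν) n∉τ))
          z≤C (below-C (inj₂ n∈ν))

      ∉ν⇒x≤qx : ∀ {x y} → Pos x y → ¬ ν x y → lin E D x y ℕ.≤ C → x ℕ.≤ qx
      ∉ν⇒x≤qx {x} {y} z-pos z∉ν z≤C = ℕₚ.≮⇒≥ λ qx<x →
        below-wedge-one-sided {A₂} {B₂} {E} {D} 1≤B₂ 1≤D {qx , qy} {tx , ty} {x , y}
          tx<qx qx<x
          (ℕₚ.≤-<-trans (bound q∈ν) (∉Under⇒< (pos t∈τ) t∉ν)) (ℕₚ.≤-<-trans (bound q∈ν) (∉Under⇒< z-pos z∉ν))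
          (subst (lin E D tx ty ℕ.≤_) (sym q-on-line) (below-C (inj₁ t∈τ))) (subst (lin E D x y ℕ.≤_) (sym q-on-line) z≤C)

      covered : ∀ x y → Under E D C x y → InConv (τ ∪ ν) x y
      covered x y (under z-pos z≤C) with Under? A₁ B₁ C₁ x y | Under? A₂ B₂ C₂ x y
      ... | yes z∈τ | _       = InConv-single (inj₁ z∈τ)
      ... | no _    | yes z∈ν = InConv-single (inj₂ z∈ν)
      ... | no z∉τ  | no z∉ν  =
        column-below (inj₁ p∈τ) (inj₂ q∈ν) (inj₂ x1∈ν) (∉τ⇒px≤x z-pos z∉τ z≤C) x≤qx px<qx
          (proj₂ (pos p∈τ)) (proj₂ (pos q∈ν)) (proj₂ z-pos) (≤⇒below z≤C)
        where
        x≤qx : x ℕ.≤ qx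
        x≤qx = ∉ν⇒x≤qx z-pos z∉ν z≤C
        x1∈ν : ν x 1
        x1∈ν = Under-downward (proj₁ z-pos) ℕₚ.≤-refl x≤qx (proj₂ (pos q∈ν)) q∈ν

      hull-line : ∃[ E ] ∃[ D ] ∃[ C ] 1 ℕ.≤ E × 1 ℕ.≤ D × HullLine (τ ∪ ν) E D C
      hull-line = E , D , C , 1≤E , 1≤D , mkHullLine (λ a b → below-C) covered

    hull-line : ∃[ E ] ∃[ D ] ∃[ C ] 1 ℕ.≤ E × 1 ℕ.≤ D × HullLine (τ ∪ ν) E D C
    hull-line with _ , _ , p∈L , q∈R , below ← Bridge.upper-bridge k L-left R-right t∈L n∈R
      = FromBridge.hull-line p∈L q∈R below

  module Meet where

    O : Sub
    O = Compl (τ ∩ ν)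

    Left Right : Pred Point 0ℓ
    Left (a , b) = a ℕ.≤ k × Pos a b × ¬ ν a b
    Right (a , b) = k ℕ.< a × Pos a b × ¬ τ a b

    Left? : Decidable Left
    Left? (a , b) = (a ℕₚ.≤? k) ×-dec ((1 ℕₚ.≤? a) ×-dec (1 ℕₚ.≤? b)) ×-dec ¬? (Under? A₂ B₂ C₂ a b)

    Right? : Decidable Right
    Right? (a , b) = (suc k ℕₚ.≤? a) ×-dec ((1 ℕₚ.≤? a) ×-dec (1 ℕₚ.≤? b)) ×-dec ¬? (Under? A₁ B₁ C₁ a b)

    L R : List Point
    L = cells Left? M
    R = cells Right? M

    ∈L⁻ : ∀ {a b} → (a , b) ∈ L → b ℕ.≤ M × Left (a , b)
    ∈L⁻ u∈ = let ((_ , b≤M) , left) = ∈-cells⁻ Left? u∈ in b≤M , left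

    ∈R⁻ : ∀ {a b} → (a , b) ∈ R → b ℕ.≤ M × Right (a , b)
    ∈R⁻ u∈ = let ((_ , b≤M) , right) = ∈-cells⁻ Right? u∈ in b≤M , right

    L-left : ∀ {u} → u ∈ L → proj₁ u ℕ.≤ k
    L-left = proj₁ ∘ proj₂ ∘ ∈L⁻

    R-right : ∀ {u} → u ∈ R → k ℕ.< proj₁ u
    R-right = proj₁ ∘ proj₂ ∘ ∈R⁻

    O⇒∈ : ∀ {a b} → O a b → a ℕ.≤ M → b ℕ.≤ M → (a , b) ∈ L ⊎ (a , b) ∈ R
    O⇒∈ {a} {b} (u-pos , ∉τ∩ν) a≤M b≤M with a ℕₚ.≤? k
    ... | yes a≤k = inj₁ (∈-cells⁺ Left? a≤M b≤M (a≤k , u-pos , λ u∈ν → ∉τ∩ν (ν⊆τ-left a≤k u∈ν , u∈ν)))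
    ... | no a≰k = inj₂ (let k<a = ℕₚ.≰⇒> a≰k in
                         ∈-cells⁺ Right? a≤M b≤M (k<a , u-pos , λ u∈τ → ∉τ∩ν (u∈τ , τ⊆ν-right k<a u∈τ)))

    t∈O : O tx ty
    t∈O = pos t∈τ , t∉ν ∘ proj₂

    n∈O : O nx ny
    n∈O = pos n∈ν , n∉τ ∘ proj₁

    t∈L : (tx , ty) ∈ L
    t∈L = ∈-cells⁺ Left? (proj₁ (τ-in-box t∈τ)) (proj₂ (τ-in-box t∈τ)) (tx≤k , pos t∈τ , t∉ν)

    n∈R : (nx , ny) ∈ R
    n∈R = ∈-cells⁺ Right? (proj₁ (ν-in-box n∈ν)) (proj₂ (ν-in-box n∈ν)) (k<nx , pos n∈ν , n∉τ)

    τ-below-M : ∀ {x y} → M ℕ.≤ x ⊎ M ℕ.≤ y → ¬ τ x y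
    τ-below-M (inj₁ M≤x) u∈τ = ℕₚ.<⇒≱ C₁<M (ℕₚ.≤-trans M≤x (proj₁ (Under-bounded 1≤A₁ 1≤B₁ u∈τ)))
    τ-below-M (inj₂ M≤y) u∈τ = ℕₚ.<⇒≱ C₁<M (ℕₚ.≤-trans M≤y (proj₂ (Under-bounded 1≤A₁ 1≤B₁ u∈τ)))

    module FromBridge {px py qx qy : ℕ} (p∈L : (px , py) ∈ L) (q∈R : (qx , qy) ∈ R)
      (above-bridge : ∀ {u} → u ∈ L ⊎ u ∈ R → 0ℤ ≤ℤ side (px , py) (qx , qy) u) where

      px≤k : px ℕ.≤ k
      px≤k = proj₁ (proj₂ (∈L⁻ p∈L))

      p-pos : Pos px py
      p-pos = proj₁ (proj₂ (proj₂ (∈L⁻ p∈L)))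

      p∉ν : ¬ ν px py
      p∉ν = proj₂ (proj₂ (proj₂ (∈L⁻ p∈L)))

      k<qx : k ℕ.< qx
      k<qx = proj₁ (proj₂ (∈R⁻ q∈R))

      q-pos : Pos qx qy
      q-pos = proj₁ (proj₂ (proj₂ (∈R⁻ q∈R)))

      q∉τ : ¬ τ qx qy
      q∉τ = proj₂ (proj₂ (proj₂ (∈R⁻ q∈R)))

      px<qx : px ℕ.< qx
      px<qx = ℕₚ.≤-<-trans px≤k k<qx

      px<nx : px ℕ.< nx
      px<nx = ℕₚ.≤-<-trans px≤k k<nx

      tx<qx : tx ℕ.< qx
      tx<qx = ℕₚ.≤-<-trans tx≤k k<qx

      -- otherwise p ∉ ν would lie below n ∈ ν
      qy<py : qy ℕ.< py
      qy<py = ℕₚ.≰⇒> λ py≤qy → p∉ν (Under-downward (proj₁ p-pos) (proj₂ p-pos) (ℕₚ.<⇒≤ px<nx)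
        (above-rising-line py≤qy (ℕₚ.<⇒≤ px<nx) px<qx (above-bridge (inj₂ n∈R))) n∈ν)

      open Line px<qx qy<py

      F : ℕ
      F = lin E D px py

      1+[F∸1]≡F : suc (F ∸ 1) ≡ F
      1+[F∸1]≡F = ℕₚ.m+[n∸m]≡n (ℕₚ.≤-trans (ℕₚ.*-mono-≤ 1≤E (proj₁ p-pos)) (ℕₚ.m≤m+n (E ℕ.* px) (D ℕ.* py)))

      above-F : ∀ {a b} → O a b → F ℕ.≤ lin E D a b
      above-F {a} {b} u∈O with a ℕₚ.≤? M | b ℕₚ.≤? M
      ... | yes a≤M | yes b≤M = above⇒≥ (above-bridge (O⇒∈ u∈O a≤M b≤M))
      ... | no a≰M | _ = ℕₚ.≤-trans (above⇒≥ (above-bridge (O⇒∈ M1∈O ℕₚ.≤-refl (s≤s z≤n))))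
                                     (lin-mono E D (ℕₚ.<⇒≤ (ℕₚ.≰⇒> a≰M)) (proj₂ (proj₁ u∈O)))
        where
        M1∈O : O M 1
        M1∈O = (s≤s z≤n , s≤s z≤n) , τ-below-M (inj₁ ℕₚ.≤-refl) ∘ proj₁
      ... | yes a≤M | no b≰M = ℕₚ.≤-trans (above⇒≥ (above-bridge (O⇒∈ aM∈O a≤M ℕₚ.≤-refl)))
                                          (lin-mono E D ℕₚ.≤-refl (ℕₚ.<⇒≤ (ℕₚ.≰⇒> b≰M)))
        where
        aM∈O : O a M
        aM∈O = (proj₁ (proj₁ u∈O) , s≤s z≤n) , τ-below-M (inj₂ ℕₚ.≤-refl) ∘ proj₁

      ∈τ∩ν⇒px≤x : ∀ {x y} → ν x y → F ℕ.≤ lin E D x y → px ℕ.≤ x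
      ∈τ∩ν⇒px≤x {x} {y} z∈ν F≤z = ℕₚ.≮⇒≥ λ x<px →
        above-wedge-one-sided {A₂} {B₂} {E} {D} 1≤B₂ 1≤D {px , py} {x , y} {nx , ny} x<px px<nx
          (ℕₚ.≤-<-trans (bound z∈ν) (∉Under⇒< p-pos p∉ν)) (ℕₚ.≤-<-trans (bound n∈ν) (∉Under⇒< p-pos p∉ν))
          F≤z (above-F n∈O)

      ∈τ∩ν⇒x≤qx : ∀ {x y} → τ x y → F ℕ.≤ lin E D x y → x ℕ.≤ qx
      ∈τ∩ν⇒x≤qx {x} {y} z∈τ F≤z = ℕₚ.≮⇒≥ λ qx<x →
        above-wedge-one-sided {A₁} {B₁} {E} {D} 1≤B₁ 1≤D {qx , qy} {tx , ty} {x , y} tx<qx qx<x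
          (ℕₚ.≤-<-trans (bound t∈τ) (∉Under⇒< q-pos q∉τ)) (ℕₚ.≤-<-trans (bound z∈τ) (∉Under⇒< q-pos q∉τ))
          (subst (ℕ._≤ lin E D tx ty) (sym q-on-line) (above-F t∈O)) (subst (ℕ._≤ lin E D x y) (sym q-on-line) F≤z)

      covered : ∀ x y → Pos x y → F ∸ 1 ℕ.< lin E D x y → InConv O x y
      covered x y z-pos F∸1<z with Under? A₁ B₁ C₁ x y | Under? A₂ B₂ C₂ x y
      ... | no z∉τ  | _       = InConv-single (z-pos , z∉τ ∘ proj₁)
      ... | yes _   | no z∉ν  = InConv-single (z-pos , z∉ν ∘ proj₂)
      ... | yes z∈τ | yes z∈ν =
        column-above (p-pos , p∉ν ∘ proj₂) (q-pos , q∉τ ∘ proj₁) xM∈O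
          (∈τ∩ν⇒px≤x z∈ν F≤z) (∈τ∩ν⇒x≤qx z∈τ F≤z) px<qx
          (proj₁ (∈L⁻ p∈L)) (proj₁ (∈R⁻ q∈R)) (proj₂ (τ-in-box z∈τ)) (≥⇒above F≤z)
        where
        F≤z : F ℕ.≤ lin E D x y
        F≤z = subst (ℕ._≤ lin E D x y) 1+[F∸1]≡F F∸1<z
        xM∈O : O x M
        xM∈O = (proj₁ z-pos , s≤s z≤n) , τ-below-M (inj₂ ℕₚ.≤-refl) ∘ proj₁

      co-hull-line : ∃[ E ] ∃[ D ] ∃[ C ] 1 ℕ.≤ E × 1 ℕ.≤ D × CoHullLine O E D C
      co-hull-line = E , D , F ∸ 1 , 1≤E , 1≤D ,
        mkCoHullLine (λ a b u∈O → subst (ℕ._≤ lin E D a b) (sym 1+[F∸1]≡F) (above-F u∈O)) covered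

    co-hull-line : ∃[ E ] ∃[ D ] ∃[ C ] 1 ℕ.≤ E × 1 ℕ.≤ D × CoHullLine O E D C
    co-hull-line with _ , _ , p∈L , q∈R , above ← Bridge.lower-bridge k L-left R-right t∈L n∈R
      = FromBridge.co-hull-line p∈L q∈R above

threshold : ∀ {P : ℕ → Set} → (∀ {x y} → P x → y ℕ.≤ x → P y) → (∀ x → Dec (P x)) →
  ∀ {m} n → P m → ¬ P n → ∃[ k ] P k × ¬ P (suc k)
threshold downward P? zero pm ¬p0 = ⊥-elim (¬p0 (downward pm z≤n))
threshold downward P? (suc n) pm ¬p1+n with P? n
... | yes pn = n , pn , ¬p1+n
... | no ¬pn = threshold downward P? n pm ¬pn

module _ {A₁ B₁ C₁ A₂ B₂ C₂ : ℕ} (1≤B₁ : 1 ℕ.≤ B₁) (1≤B₂ : 1 ℕ.≤ B₂) (steeper : B₁ ℕ.* A₂ ℕ.≤ B₂ ℕ.* A₁) where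

  -- In column x the line A₂ x + B₂ y = C₂ is not above A₁ x + B₁ y = C₁.
  LowerAt : ℕ → Set
  LowerAt x = B₁ ℕ.* C₂ ℕ.+ B₂ ℕ.* A₁ ℕ.* x ℕ.≤ B₂ ℕ.* C₁ ℕ.+ B₁ ℕ.* A₂ ℕ.* x

  LowerAt? : ∀ x → Dec (LowerAt x)
  LowerAt? x = _ ℕₚ.≤? _

  private
    instance
      B₁-nonZero : ℕ.NonZero B₁
      B₁-nonZero = ℕ.>-nonZero 1≤B₁
      B₂-nonZero : ℕ.NonZero B₂
      B₂-nonZero = ℕ.>-nonZero 1≤B₂

    cross-multiplied : ∀ x y → B₂ ℕ.* lin A₁ B₁ x y ℕ.+ B₁ ℕ.* A₂ ℕ.* x ≡ B₁ ℕ.* lin A₂ B₂ x y ℕ.+ B₂ ℕ.* A₁ ℕ.* x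
    cross-multiplied x y = lemma A₁ B₁ A₂ B₂ x y
      where
      lemma : ∀ A₁ B₁ A₂ B₂ x y → B₂ ℕ.* (A₁ ℕ.* x ℕ.+ B₁ ℕ.* y) ℕ.+ B₁ ℕ.* A₂ ℕ.* x ≡
                                  B₁ ℕ.* (A₂ ℕ.* x ℕ.+ B₂ ℕ.* y) ℕ.+ B₂ ℕ.* A₁ ℕ.* x
      lemma = ℕ-Solver.solve-∀

  LowerAt⇒⊆ : ∀ {x y} → LowerAt x → lin A₂ B₂ x y ℕ.≤ C₂ → lin A₁ B₁ x y ℕ.≤ C₁
  LowerAt⇒⊆ {x} {y} lower ν≤ = ℕₚ.*-cancelˡ-≤ B₂ (ℕₚ.+-cancelʳ-≤ (B₁ ℕ.* A₂ ℕ.* x) _ _ (begin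
    B₂ ℕ.* lin A₁ B₁ x y ℕ.+ B₁ ℕ.* A₂ ℕ.* x ≡⟨ cross-multiplied x y ⟩
    B₁ ℕ.* lin A₂ B₂ x y ℕ.+ B₂ ℕ.* A₁ ℕ.* x ≤⟨ ℕₚ.+-monoˡ-≤ (B₂ ℕ.* A₁ ℕ.* x) (ℕₚ.*-monoʳ-≤ B₁ ν≤) ⟩
    B₁ ℕ.* C₂ ℕ.+ B₂ ℕ.* A₁ ℕ.* x          ≤⟨ lower ⟩
    B₂ ℕ.* C₁ ℕ.+ B₁ ℕ.* A₂ ℕ.* x          ∎))
    where open ℕₚ.≤-Reasoning

  ¬LowerAt⇒⊇ : ∀ {x y} → ¬ LowerAt x → lin A₁ B₁ x y ℕ.≤ C₁ → lin A₂ B₂ x y ℕ.≤ C₂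
  ¬LowerAt⇒⊇ {x} {y} ¬lower τ≤ =
    ℕₚ.*-cancelˡ-≤ B₁ (ℕₚ.<⇒≤ (ℕₚ.+-cancelʳ-< (B₂ ℕ.* A₁ ℕ.* x) (B₁ ℕ.* lin A₂ B₂ x y) (B₁ ℕ.* C₂) (begin-strict
    B₁ ℕ.* lin A₂ B₂ x y ℕ.+ B₂ ℕ.* A₁ ℕ.* x ≡⟨ cross-multiplied x y ⟨
    B₂ ℕ.* lin A₁ B₁ x y ℕ.+ B₁ ℕ.* A₂ ℕ.* x ≤⟨ ℕₚ.+-monoˡ-≤ (B₁ ℕ.* A₂ ℕ.* x) (ℕₚ.*-monoʳ-≤ B₂ τ≤) ⟩
    B₂ ℕ.* C₁ ℕ.+ B₁ ℕ.* A₂ ℕ.* x          <⟨ ℕₚ.≰⇒> ¬lower ⟩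
    B₁ ℕ.* C₂ ℕ.+ B₂ ℕ.* A₁ ℕ.* x          ∎)))
    where open ℕₚ.≤-Reasoning

  -- the steeper line loses height faster
  LowerAt-downward : ∀ {x x′} → LowerAt x → x′ ℕ.≤ x → LowerAt x′
  LowerAt-downward {x} {x′} lower x′≤x with d , refl ← ℕₚ.m≤n⇒∃[o]m+o≡n x′≤x =
    ℕₚ.+-cancelʳ-≤ (B₂ ℕ.* A₁ ℕ.* d) _ _ (begin
      B₁ ℕ.* C₂ ℕ.+ B₂ ℕ.* A₁ ℕ.* x′ ℕ.+ B₂ ℕ.* A₁ ℕ.* d ≡⟨ split (B₁ ℕ.* C₂) (B₂ ℕ.* A₁) x′ d ⟨
      B₁ ℕ.* C₂ ℕ.+ B₂ ℕ.* A₁ ℕ.* (x′ ℕ.+ d)            ≤⟨ lower ⟩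
      B₂ ℕ.* C₁ ℕ.+ B₁ ℕ.* A₂ ℕ.* (x′ ℕ.+ d)            ≡⟨ split (B₂ ℕ.* C₁) (B₁ ℕ.* A₂) x′ d ⟩
      B₂ ℕ.* C₁ ℕ.+ B₁ ℕ.* A₂ ℕ.* x′ ℕ.+ B₁ ℕ.* A₂ ℕ.* d ≤⟨ ℕₚ.+-monoʳ-≤ _ (ℕₚ.*-monoˡ-≤ d steeper) ⟩
      B₂ ℕ.* C₁ ℕ.+ B₁ ℕ.* A₂ ℕ.* x′ ℕ.+ B₂ ℕ.* A₁ ℕ.* d ∎)
    where
    open ℕₚ.≤-Reasoning
    split : ∀ c a x d → c ℕ.+ a ℕ.* (x ℕ.+ d) ≡ c ℕ.+ a ℕ.* x ℕ.+ a ℕ.* d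
    split = ℕ-Solver.solve-∀

  crossing-column : ∀ {tx ty nx ny} →
    Under A₁ B₁ C₁ tx ty → ¬ Under A₂ B₂ C₂ tx ty → Under A₂ B₂ C₂ nx ny → ¬ Under A₁ B₁ C₁ nx ny →
    ∃[ k ] (∀ {x y} → x ℕ.≤ k → Under A₂ B₂ C₂ x y → Under A₁ B₁ C₁ x y)
         × (∀ {x y} → k ℕ.< x → Under A₁ B₁ C₁ x y → Under A₂ B₂ C₂ x y)
  crossing-column {tx} {nx = nx} t∈τ t∉ν n∈ν n∉τ = k , left , right
    where
    lower-t : LowerAt tx
    lower-t = Dec.decidable-stable (LowerAt? tx) (λ ¬lower → t∉ν (under (pos t∈τ) (¬LowerAt⇒⊇ ¬lower (bound t∈τ))))
    ¬lower-n : ¬ LowerAt nx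
    ¬lower-n lower = n∉τ (under (pos n∈ν) (LowerAt⇒⊆ lower (bound n∈ν)))
    crossing : ∃[ k ] LowerAt k × ¬ LowerAt (suc k)
    crossing = threshold LowerAt-downward LowerAt? nx lower-t ¬lower-n
    k : ℕ
    k = proj₁ crossing
    left : ∀ {x y} → x ℕ.≤ k → Under A₂ B₂ C₂ x y → Under A₁ B₁ C₁ x y
    left x≤k (under z-pos ν≤) = under z-pos (LowerAt⇒⊆ (LowerAt-downward (proj₁ (proj₂ crossing)) x≤k) ν≤)
    right : ∀ {x y} → k ℕ.< x → Under A₁ B₁ C₁ x y → Under A₂ B₂ C₂ x y
    right k<x (under z-pos τ≤) =
      under z-pos (¬LowerAt⇒⊇ (λ lower-x → proj₂ (proj₂ crossing) (LowerAt-downward lower-x k<x)) τ≤)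

-- Join and meet

Under-points : ℕ → ℕ → ℕ → List Point
Under-points A B C = cells (λ (x , y) → Under? A B C x y) C

Under-⊆? : ∀ A₁ B₁ C₁ {A₂ B₂ C₂} → 1 ℕ.≤ A₂ → 1 ℕ.≤ B₂ →
  Under A₂ B₂ C₂ ⊆ Under A₁ B₁ C₁ ⊎ ∃[ x ] ∃[ y ] Under A₂ B₂ C₂ x y × ¬ Under A₁ B₁ C₁ x y
Under-⊆? A₁ B₁ C₁ {A₂} {B₂} {C₂} 1≤A₂ 1≤B₂ with all? (λ (x , y) → Under? A₁ B₁ C₁ x y) (Under-points A₂ B₂ C₂)
... | yes all₁ = inj₁ λ x y u →
  All.lookup all₁ (∈-cells⁺ _ (proj₁ (Under-bounded 1≤A₂ 1≤B₂ u)) (proj₂ (Under-bounded 1≤A₂ 1≤B₂ u)) u)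
... | no ¬all₁ with (x , y) , u∈ , u∉₁ ← find (¬All⇒Any¬ (λ (x , y) → Under? A₁ B₁ C₁ x y) _ ¬all₁)
  = inj₂ (x , y , proj₂ (∈-cells⁻ _ u∈) , u∉₁)

JoinMeetLines : Sub → Sub → Set
JoinMeetLines τ ν = (∃[ A ] ∃[ B ] ∃[ C ] 1 ℕ.≤ A × 1 ℕ.≤ B × HullLine (τ ∪ ν) A B C)
                  × (∃[ A ] ∃[ B ] ∃[ C ] 1 ℕ.≤ A × 1 ℕ.≤ B × CoHullLine (Compl (τ ∩ ν)) A B C)

HullLine-resp : ∀ {S T : Sub} {A B C} → S ≐ T → HullLine S A B C → HullLine T A B C
HullLine-resp S≐T (mkHullLine below covers) =
  mkHullLine (λ a b t → below a b (from (S≐T a b) t)) (λ x y u → InConv-mono (λ a b → to (S≐T a b)) {x} {y} (covers x y u))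

CoHullLine-resp : ∀ {S T : Sub} {A B C} → S ≐ T → CoHullLine S A B C → CoHullLine T A B C
CoHullLine-resp S≐T (mkCoHullLine above covers) =
  mkCoHullLine (λ a b t → above a b (from (S≐T a b) t))
               (λ x y z-pos C<z → InConv-mono (λ a b → to (S≐T a b)) {x} {y} (covers x y z-pos C<z))

JoinMeetLines-resp : ∀ {τ ν τ′ ν′} → τ ≐ τ′ → ν ≐ ν′ → JoinMeetLines τ ν → JoinMeetLines τ′ ν′
JoinMeetLines-resp {τ} {ν} {τ′} {ν′} τ≐ ν≐ ((A , B , C , 1≤A , 1≤B , join) , (A′ , B′ , C′ , 1≤A′ , 1≤B′ , meet)) =
  (A , B , C , 1≤A , 1≤B , HullLine-resp ∪≐ join) , (A′ , B′ , C′ , 1≤A′ , 1≤B′ , CoHullLine-resp Compl∩≐ meet)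
  where
  ∪≐ : (τ ∪ ν) ≐ (τ′ ∪ ν′)
  ∪≐ x y = mk⇔ (Sum.map (to (τ≐ x y)) (to (ν≐ x y))) (Sum.map (from (τ≐ x y)) (from (ν≐ x y)))
  Compl∩≐ : Compl (τ ∩ ν) ≐ Compl (τ′ ∩ ν′)
  Compl∩≐ x y = mk⇔ (Product.map₂ (λ ∉ (t , v) → ∉ (from (τ≐ x y) t , from (ν≐ x y) v)))
                    (Product.map₂ (λ ∉ (t , v) → ∉ (to (τ≐ x y) t , to (ν≐ x y) v)))

JoinMeetLines-sym : ∀ {τ ν} → JoinMeetLines τ ν → JoinMeetLines ν τ
JoinMeetLines-sym ((A , B , C , 1≤A , 1≤B , join) , (A′ , B′ , C′ , 1≤A′ , 1≤B′ , meet)) =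
  (A , B , C , 1≤A , 1≤B , HullLine-resp (λ x y → mk⇔ Sum.swap Sum.swap) join) ,
  (A′ , B′ , C′ , 1≤A′ , 1≤B′ ,
   CoHullLine-resp (λ x y → mk⇔ (Product.map₂ (_∘ Product.swap)) (Product.map₂ (_∘ Product.swap))) meet)

nested-lines : ∀ {A₁ B₁ C₁ A₂ B₂ C₂} → 1 ℕ.≤ A₁ → 1 ℕ.≤ B₁ → 1 ℕ.≤ A₂ → 1 ℕ.≤ B₂ →
  Under A₂ B₂ C₂ ⊆ Under A₁ B₁ C₁ → JoinMeetLines (Under A₁ B₁ C₁) (Under A₂ B₂ C₂)
nested-lines {A₁} {B₁} {C₁} {A₂} {B₂} {C₂} 1≤A₁ 1≤B₁ 1≤A₂ 1≤B₂ ν⊆τ =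
  (A₁ , B₁ , C₁ , 1≤A₁ , 1≤B₁ , mkHullLine (λ a b → bound ∘ [ id , ν⊆τ a b ]′) (λ x y u → InConv-single (inj₁ u))) ,
  (A₂ , B₂ , C₂ , 1≤A₂ , 1≤B₂ , mkCoHullLine (λ a b (u-pos , ∉τ∩ν) → ∉Under⇒< u-pos (λ v → ∉τ∩ν (ν⊆τ a b v , v)))
                                              (λ x y z-pos C<z → InConv-single (z-pos , λ (_ , v) → ℕₚ.<⇒≱ C<z (bound v))))

crossing-lines : ∀ {A₁ B₁ C₁ A₂ B₂ C₂} → 1 ℕ.≤ A₁ → 1 ℕ.≤ B₁ → 1 ℕ.≤ A₂ → 1 ℕ.≤ B₂ → B₁ ℕ.* A₂ ℕ.≤ B₂ ℕ.* A₁ →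
  ∀ {tx ty nx ny} → Under A₁ B₁ C₁ tx ty → ¬ Under A₂ B₂ C₂ tx ty → Under A₂ B₂ C₂ nx ny → ¬ Under A₁ B₁ C₁ nx ny →
  JoinMeetLines (Under A₁ B₁ C₁) (Under A₂ B₂ C₂)
crossing-lines 1≤A₁ 1≤B₁ 1≤A₂ 1≤B₂ steeper t∈τ t∉ν n∈ν n∉τ
  with k , ν⊆τ-left , τ⊆ν-right ← crossing-column 1≤B₁ 1≤B₂ steeper t∈τ t∉ν n∈ν n∉τ
  = Join.hull-line , Meet.co-hull-line
  where open Crossing 1≤A₁ 1≤B₁ 1≤A₂ 1≤B₂ k ν⊆τ-left τ⊆ν-right t∈τ t∉ν n∈ν n∉τ

under-join-meet-lines : ∀ {A₁ B₁ C₁ A₂ B₂ C₂} → 1 ℕ.≤ A₁ → 1 ℕ.≤ B₁ → 1 ℕ.≤ A₂ → 1 ℕ.≤ B₂ →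
  JoinMeetLines (Under A₁ B₁ C₁) (Under A₂ B₂ C₂)
under-join-meet-lines {A₁} {B₁} {C₁} {A₂} {B₂} {C₂} 1≤A₁ 1≤B₁ 1≤A₂ 1≤B₂
  with Under-⊆? A₁ B₁ C₁ 1≤A₂ 1≤B₂ | Under-⊆? A₂ B₂ C₂ 1≤A₁ 1≤B₁
... | inj₁ ν⊆τ | _        = nested-lines 1≤A₁ 1≤B₁ 1≤A₂ 1≤B₂ ν⊆τ
... | inj₂ _   | inj₁ τ⊆ν = JoinMeetLines-sym (nested-lines 1≤A₂ 1≤B₂ 1≤A₁ 1≤B₁ τ⊆ν)
... | inj₂ (_ , _ , n∈ν , n∉τ) | inj₂ (_ , _ , t∈τ , t∉ν) with B₁ ℕ.* A₂ ℕₚ.≤? B₂ ℕ.* A₁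
...   | yes steeper = crossing-lines 1≤A₁ 1≤B₁ 1≤A₂ 1≤B₂ steeper t∈τ t∉ν n∈ν n∉τ
...   | no ¬steeper = JoinMeetLines-sym (crossing-lines 1≤A₂ 1≤B₂ 1≤A₁ 1≤B₁ (ℕₚ.<⇒≤ (ℕₚ.≰⇒> ¬steeper)) n∈ν n∉τ t∈τ t∉ν)

≐-sym : ∀ {S T : Sub} → S ≐ T → T ≐ S
≐-sym S≐T x y = ⇔.sym (S≐T x y)

UnderLine-dec : ∀ {τ} → UnderLine τ → ∀ x y → Dec (τ x y)
UnderLine-dec (A , B , C , _ , _ , τ≐) x y = Dec.map (⇔.sym (τ≐ x y)) (Under? A B C x y)

UnderLine-pos : ∀ {τ} → UnderLine τ → ∀ {x y} → τ x y → Pos x y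
UnderLine-pos (_ , _ , _ , _ , _ , τ≐) {x} {y} = pos ∘ to (τ≐ x y)

HullLine⇒isJoin : ∀ {τ ν A B C} → UnderLine τ → UnderLine ν → 1 ℕ.≤ A → 1 ℕ.≤ B →
  HullLine (τ ∪ ν) A B C → IsJoinΔ τ ν (JoinΔ τ ν)
HullLine⇒isJoin {τ} {ν} {A} {B} {C} τ-line ν-line 1≤A 1≤B (mkHullLine below covers) =
  underLine⇒triangular (A , B , C , 1≤A , 1≤B , λ x y →
    mk⇔ (λ (z-pos , z∈hull) → under z-pos (InConv-≤ z∈hull {A} {B} {C} below)) (λ z → pos z , covers x y z)) ,
  (λ x y t → UnderLine-pos τ-line t , InConv-single (inj₁ t)) ,
  (λ x y v → UnderLine-pos ν-line v , InConv-single (inj₂ v)) ,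
  least
  where
  least : ∀ σ → Triangular σ → τ ⊆ σ → ν ⊆ σ → JoinΔ τ ν ⊆ σ
  least σ σ-tri τ⊆σ ν⊆σ x y (z-pos , z∈hull) with A′ , B′ , C′ , _ , _ , σ≐ ← triangular⇒underLine σ-tri =
    from (σ≐ x y) (under z-pos (InConv-≤ z∈hull {A′} {B′} {C′} (λ a b → bound ∘ to (σ≐ a b) ∘ [ τ⊆σ a b , ν⊆σ a b ]′)))

CoHullLine⇒isMeet : ∀ {τ ν A B C} → UnderLine τ → UnderLine ν → 1 ℕ.≤ A → 1 ℕ.≤ B →
  CoHullLine (Compl (τ ∩ ν)) A B C → IsMeetΔ τ ν (MeetΔ τ ν)
CoHullLine⇒isMeet {τ} {ν} {A} {B} {C} τ-line ν-line 1≤A 1≤B (mkCoHullLine above covers) =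
  underLine⇒triangular (A , B , C , 1≤A , 1≤B , λ x y →
    mk⇔ (λ (z-pos , z∉hull) → under z-pos (ℕₚ.≮⇒≥ λ C<z → z∉hull (z-pos , covers x y z-pos C<z)))
        (λ (under z-pos z≤C) → z-pos , λ (_ , z∈hull) → ℕₚ.<⇒≱ (InConv-≥ z∈hull {A} {B} {suc C} above) z≤C)) ,
  (λ x y (z-pos , z∉hull) → Dec.decidable-stable (UnderLine-dec τ-line x y)
    λ z∉τ → z∉hull (z-pos , InConv-single (z-pos , z∉τ ∘ proj₁))) ,
  (λ x y (z-pos , z∉hull) → Dec.decidable-stable (UnderLine-dec ν-line x y)
    λ z∉ν → z∉hull (z-pos , InConv-single (z-pos , z∉ν ∘ proj₂))) ,
  greatest
  where
  greatest : ∀ σ → Triangular σ → σ ⊆ τ → σ ⊆ ν → σ ⊆ MeetΔ τ ν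
  greatest σ σ-tri σ⊆τ σ⊆ν x y z∈σ with A′ , B′ , C′ , _ , _ , σ≐ ← triangular⇒underLine σ-tri =
    pos (to (σ≐ x y) z∈σ) , λ (_ , z∈hull) → ℕₚ.<⇒≱ (InConv-≥ z∈hull {A′} {B′} {suc C′} outside-σ) (bound (to (σ≐ x y) z∈σ))
    where
    outside-σ : ∀ a b → Compl (τ ∩ ν) a b → C′ ℕ.< lin A′ B′ a b
    outside-σ a b (u-pos , ∉τ∩ν) = ∉Under⇒< u-pos λ u → let u∈σ = from (σ≐ a b) u in ∉τ∩ν (σ⊆τ a b u∈σ , σ⊆ν a b u∈σ)

proposition4p2 : (τ ν : Sub) → Triangular τ → Triangular ν →
    IsJoinΔ τ ν (JoinΔ τ ν) × IsMeetΔ τ ν (MeetΔ τ ν)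
proposition4p2 τ ν τ-tri ν-tri
  with τ-line@(_ , _ , _ , 1≤A₁ , 1≤B₁ , τ≐) ← triangular⇒underLine τ-tri
  with ν-line@(_ , _ , _ , 1≤A₂ , 1≤B₂ , ν≐) ← triangular⇒underLine ν-tri
  with (_ , _ , _ , 1≤A , 1≤B , join) , (_ , _ , _ , 1≤A′ , 1≤B′ , meet)
         ← JoinMeetLines-resp (≐-sym τ≐) (≐-sym ν≐) (under-join-meet-lines 1≤A₁ 1≤B₁ 1≤A₂ 1≤B₂)
  = HullLine⇒isJoin τ-line ν-line 1≤A 1≤B join , CoHullLine⇒isMeet τ-line ν-line 1≤A′ 1≤B′ meet
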